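{- Let $t \ge 3$ be odd. Then $K_{6[t]}^*$ admits a $\vec{C}_t$-factorization.
   Context: $K_{n[m]}^*$ denotes the complete symmetric equipartite digraph with $n$ parts of size $m$: vertex set partitioned into $n$ parts of size $m$, with $(u,v)$ an arc if and only if $u,v$ lie in different parts. $\vec{C}_t$ is the directed cycle of length $t$. A $\vec{C}_t$-factor of a digraph $D$ is a spanning subdigraph that is a disjoint union of directed $t$-cycles; a $\vec{C}_t$-factorization of $D$ is a set of $\vec{C}_t$-factors whose arc sets partition $A(D)$. -}

module Defs where

open import Data.Nat using (ℕ; zero; suc)
open import Data.Nat.DivMod using (_mod_)
open import Data.Fin using (Fin; toℕ)
open import Data.Product using (Σ; ∃; _×_; _,_; proj₁; proj₂)
open import Relation.Binary.PropositionalEquality using (_≡_; _≢_)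
open import Level using (0ℓ) renaming (suc to lsuc)

record Digraph : Set₁ where
  field
    V   : Set
    Arc : V → V → Set
open Digraph public

ExactlyOne : {A B : Set} → (A → B) → B → Set
ExactlyOne {A} f y = Σ A λ x → (f x ≡ y) × (∀ x′ → f x′ ≡ y → x′ ≡ x)

K* : ℕ → ℕ → Digraph
K* n m = record { V = Fin n × Fin m ; Arc = λ u v → proj₁ u ≢ proj₁ v }

next : ∀ {t} → Fin t → Fin t
next {suc k} i = suc (toℕ i) mod suc k

-- A C⃗_t-factor of D: k directed t-cycles (cycle j visits cyc j 0, cyc j 1, ...,
-- cyc j (t-1), back to cyc j 0), each consecutive pair an arc of D, such that
-- every vertex of D lies on exactly one cycle at exactly one position
-- (spanning + vertex-disjoint; this also makes each cycle injective).
record CFactor (t : ℕ) (D : Digraph) : Set where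
  field
    k       : ℕ
    cyc     : Fin k → Fin t → V D
    arcs    : ∀ j i → Arc D (cyc j i) (cyc j (next i))
    partitionV : ∀ v → ExactlyOne (λ (p : Fin k × Fin t) → cyc (proj₁ p) (proj₂ p)) v
open CFactor public

arcOf : ∀ {t D} (F : CFactor t D) → Fin (k F) × Fin t → V D × V D
arcOf F (j , i) = cyc F j i , cyc F j (next i)

-- A C⃗_t-factorization of D: r factors whose arc sets partition A(D):
-- every arc of D is contributed by exactly one (factor, cycle, position).
-- (Arcs of factors are arcs of D by CFactor.arcs.)
record CFactorization (t : ℕ) (D : Digraph) : Set where
  field
    r       : ℕ
    factor  : Fin r → CFactor t D
    partitionA : ∀ u v → Arc D u v →
      ExactlyOne (λ (q : Σ (Fin r) λ f → Fin (k (factor f)) × Fin t) →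
                    arcOf (factor (proj₁ q)) (proj₂ q))
                 (u , v)
open CFactorization public

-- Write t = 2m + 1, view the six parts as ℤ₅ ∪ {∞} and index the vertices of each part by ℤ_t.
-- The group ℤ₅ × ℤ_t acts by rotating the parts (fixing ∞) and translating the indices; we give one
-- base C⃗_t-factor (six directed t-cycles, with integer labels as vertex indices) and take its 5t
-- translates.  Each translate is a C⃗_t-factor because the base factor meets every part in a complete
-- residue system mod t.  The translates partition the arcs because the 30 ordered pairs of distinct
-- parts form six free ℤ₅-orbits and, for every orbit o and residue d, exactly one step of the base
-- factor joins parts in orbit o with labels differing by d.  All labels are affine in m and in the
-- position along the cycle, so these conditions come down to finitely many identities between affine
-- forms, which are checked by computation.
module Submission where

open import Defs
open import Data.Nat as ℕ using (ℕ; _≤_; zero; suc; NonZero)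
open import Data.Nat.Divisibility using (_∣_; divides)
open import Relation.Nullary using (¬_; Dec; yes; no)

import Data.Nat.Properties as ℕ
open import Data.Nat.DivMod as DM using (_mod_)
open import Data.Fin.Patterns using (0F; 1F; 2F; 3F; 4F; 5F)
open import Data.Fin.Relation.Unary.Top using (View; view; ‵fromℕ; ‵inject₁; view-fromℕ; view-inject₁)
open import Data.Integer as ℤ using (ℤ; +_; -[1+_]; _+_; _-_; _*_; -_; 0ℤ; 1ℤ; -1ℤ)
import Data.Integer.Properties as ℤ
open import Data.Integer.DivMod using (n%ℕd<d; a≡a%ℕn+[a/ℕn]*n)
open import Data.Integer.Tactic.RingSolver using (solve-∀)
open import Data.Fin as Fin using (Fin; toℕ; fromℕ<)
import Data.Fin.Properties as Fin
open import Data.Product using (Σ; ∃-syntax; _×_; _,_; proj₁; proj₂; uncurry)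
open import Data.Product.Properties using (≡-dec)
open import Data.Empty using (⊥-elim)
open import Relation.Nullary.Decidable using (from-yes; _⊎-dec_; _×-dec_; ¬?)
open import Data.Sum using (_⊎_; inj₁; inj₂)
open import Relation.Binary using (Setoid; DecidableEquality)
open import Relation.Binary.PropositionalEquality hiding ([_])
import Relation.Binary.Reasoning.Setoid
open import Function using (_∘_)

toℤ : ∀ {n} → Fin n → ℤ
toℤ i = + toℕ i

inverse⇒exactlyOne : {A B : Set} (f : A → B) (g : B → A) →
  (∀ x → g (f x) ≡ x) → ∀ y → f (g y) ≡ y → ExactlyOne f y
inverse⇒exactlyOne f g g∘f y f∘g = g y , f∘g , λ x fx≡y → trans (sym (g∘f x)) (cong g fx≡y)

-- Residues modulo t

module Modulo (t : ℕ) .{{_ : NonZero t}} where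

  infix 4 _≈_
  record _≈_ (a b : ℤ) : Set where
    constructor multiple
    field
      quotient : ℤ
      equation : a ≡ b + quotient * + t

  ≡⇒≈ : ∀ {a b} → a ≡ b → a ≈ b
  ≡⇒≈ {a} refl = multiple 0ℤ (sym (ℤ.+-identityʳ a))

  ≈-refl : ∀ {a} → a ≈ a
  ≈-refl = ≡⇒≈ refl

  ≈-sym : ∀ {a b} → a ≈ b → b ≈ a
  ≈-sym {a} {b} (multiple q a≡) = multiple (- q) (begin
    b                          ≡⟨ cancel b q (+ t) ⟩
    b + q * + t + - q * + t    ≡⟨ cong (_+ - q * + t) (sym a≡) ⟩
    a + - q * + t              ∎)
    where open ≡-Reasoning
          cancel : ∀ b q t → b ≡ b + q * t + - q * t
          cancel = solve-∀

  ≈-trans : ∀ {a b c} → a ≈ b → b ≈ c → a ≈ c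
  ≈-trans {a} {b} {c} (multiple q a≡) (multiple r b≡) = multiple (r + q) (begin
    a                    ≡⟨ a≡ ⟩
    b + q * + t          ≡⟨ cong (_+ q * + t) b≡ ⟩
    c + r * + t + q * + t ≡⟨ collect c r q (+ t) ⟩
    c + (r + q) * + t    ∎)
    where open ≡-Reasoning
          collect : ∀ c r q t → c + r * t + q * t ≡ c + (r + q) * t
          collect = solve-∀

  ≈-setoid : Setoid _ _
  ≈-setoid = record
    { Carrier = ℤ
    ; _≈_ = _≈_
    ; isEquivalence = record { refl = ≈-refl ; sym = ≈-sym ; trans = ≈-trans }
    }

  +-cong : ∀ {a b c d} → a ≈ b → c ≈ d → a + c ≈ b + d
  +-cong {a} {b} {c} {d} (multiple q a≡) (multiple r c≡) = multiple (q + r) (begin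
    a + c                         ≡⟨ cong₂ _+_ a≡ c≡ ⟩
    b + q * + t + (d + r * + t)   ≡⟨ collect b d q r (+ t) ⟩
    b + d + (q + r) * + t         ∎)
    where open ≡-Reasoning
          collect : ∀ b d q r t → b + q * t + (d + r * t) ≡ b + d + (q + r) * t
          collect = solve-∀

  -‿cong : ∀ {a b} → a ≈ b → - a ≈ - b
  -‿cong {a} {b} (multiple q a≡) = multiple (- q) (begin
    - a               ≡⟨ cong -_ a≡ ⟩
    - (b + q * + t)   ≡⟨ distribute b q (+ t) ⟩
    - b + - q * + t   ∎)
    where open ≡-Reasoning
          distribute : ∀ b q t → - (b + q * t) ≡ - b + - q * t
          distribute = solve-∀

  module ≈-Reasoning = Relation.Binary.Reasoning.Setoid ≈-setoid

  reduce : ℤ → Fin t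
  reduce a = fromℕ< (n%ℕd<d a t)

  reduce-≈ : ∀ a → toℤ (reduce a) ≈ a
  reduce-≈ a = ≈-sym (multiple (a ℤ./ℕ t) (trans (a≡a%ℕn+[a/ℕn]*n a t)
    (cong (λ r → + r + (a ℤ./ℕ t) * + t) (sym (Fin.toℕ-fromℕ< (n%ℕd<d a t))))))

  private
    below-modulus : ∀ {x} y q → x ℕ.< t → + x ≢ + y + + suc q * + t
    below-modulus {x} y q x<t x≡ = ℕ.<⇒≱ x<t (begin
      t                   ≤⟨ ℕ.m≤m+n t (q ℕ.* t) ⟩
      suc q ℕ.* t         ≤⟨ ℕ.m≤n+m (suc q ℕ.* t) y ⟩
      y ℕ.+ suc q ℕ.* t   ≡⟨ ℤ.+-injective (trans as-ℤ (sym x≡)) ⟩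
      x                   ∎)
      where
        open ℕ.≤-Reasoning
        as-ℤ : + (y ℕ.+ suc q ℕ.* t) ≡ + y + + suc q * + t
        as-ℤ = trans (ℤ.pos-+ y (suc q ℕ.* t)) (cong (_+_ (+ y)) (ℤ.pos-* (suc q) t))

  toℤ-injective-≈ : ∀ (x y : Fin t) → toℤ x ≈ toℤ y → x ≡ y
  toℤ-injective-≈ x y (multiple (+ zero) x≡) = Fin.toℕ-injective (ℤ.+-injective (trans x≡ (ℤ.+-identityʳ (toℤ y))))
  toℤ-injective-≈ x y (multiple (+ suc q) x≡) = ⊥-elim (below-modulus (toℕ y) q (Fin.toℕ<n x) x≡)
  toℤ-injective-≈ x y (multiple -[1+ q ] x≡) = ⊥-elim (below-modulus (toℕ x) q (Fin.toℕ<n y) (_≈_.equation (≈-sym (multiple -[1+ q ] x≡))))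

  reduce-unique : ∀ {a} (x : Fin t) → a ≈ toℤ x → reduce a ≡ x
  reduce-unique {a} x a≈x = toℤ-injective-≈ (reduce a) x (≈-trans (reduce-≈ a) a≈x)

  reduce-cong : ∀ {a b} → a ≈ b → reduce a ≡ reduce b
  reduce-cong {a} {b} a≈b = reduce-unique (reduce b) (≈-trans a≈b (≈-sym (reduce-≈ b)))

-- Rotations of the parts and orbits of pairs of parts

infixl 6 _+₅_ _-₅_
_+₅_ _-₅_ : Fin 5 → Fin 5 → Fin 5
f +₅ g = (toℕ f ℕ.+ toℕ g) mod 5
f -₅ g = (5 ℕ.+ toℕ f ℕ.∸ toℕ g) mod 5

-- The six parts are ℤ₅ ∪ {∞}: inject₁ p stands for p ∈ ℤ₅ and the last element for ∞, which rotations fix.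
rotate : Fin 5 → Fin 6 → Fin 6
rotate f P with view P
... | ‵fromℕ = Fin.fromℕ 5
... | ‵inject₁ p = Fin.inject₁ (p +₅ f)

rotate-+₅ : ∀ f g P → rotate f (rotate g P) ≡ rotate (f +₅ g) P
rotate-+₅ = from-yes (Fin.all? λ f → Fin.all? λ g → Fin.all? λ P → rotate f (rotate g P) Fin.≟ rotate (f +₅ g) P)

-₅-+₅ : ∀ f g → f -₅ g +₅ g ≡ f
-₅-+₅ = from-yes (Fin.all? λ f → Fin.all? λ g → f -₅ g +₅ g Fin.≟ f)

+₅--₅ : ∀ f g → f +₅ g -₅ g ≡ f
+₅--₅ = from-yes (Fin.all? λ f → Fin.all? λ g → f +₅ g -₅ g Fin.≟ f)

rotate-zero : ∀ P → rotate 0F P ≡ P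
rotate-zero = from-yes (Fin.all? λ P → rotate 0F P Fin.≟ P)

unrotate : Fin 5 → Fin 6 → Fin 6
unrotate f = rotate (Fin.zero -₅ f)

unrotate-rotate : ∀ f P → unrotate f (rotate f P) ≡ P
unrotate-rotate = from-yes (Fin.all? λ f → Fin.all? λ P → unrotate f (rotate f P) Fin.≟ P)

rotate-unrotate : ∀ f P → rotate f (unrotate f P) ≡ P
rotate-unrotate = from-yes (Fin.all? λ f → Fin.all? λ P → rotate f (unrotate f P) Fin.≟ P)

rotate-injective : ∀ f {P Q} → rotate f P ≡ rotate f Q → P ≡ Q
rotate-injective f {P} {Q} eq = begin
  P                        ≡⟨ sym (unrotate-rotate f P) ⟩
  unrotate f (rotate f P)  ≡⟨ cong (unrotate f) eq ⟩
  unrotate f (rotate f Q)  ≡⟨ unrotate-rotate f Q ⟩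
  Q                        ∎
  where open ≡-Reasoning

-- Representatives of the six rotation orbits of ordered pairs of distinct parts:
-- (∞,1), (4,∞), and (x,x+d) for d = 1, 4, 2, 3.
orbitTail orbitHead : Fin 6 → Fin 6
orbitTail 0F = 5F
orbitTail 1F = 4F
orbitTail 2F = 4F
orbitTail 3F = 3F
orbitTail 4F = 0F
orbitTail 5F = 3F
orbitHead 0F = 1F
orbitHead 1F = 5F
orbitHead 2F = 0F
orbitHead 3F = 2F
orbitHead 4F = 2F
orbitHead 5F = 1F

orbitTail≢orbitHead : ∀ o → orbitTail o ≢ orbitHead o
orbitTail≢orbitHead = from-yes (Fin.all? λ o → ¬? (orbitTail o Fin.≟ orbitHead o))

rotatedRepresentative : Fin 6 × Fin 5 → Fin 6 × Fin 6
rotatedRepresentative (o , f) = rotate f (orbitTail o) , rotate f (orbitHead o)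

-- The orbit of (P , Q) and the rotation carrying its representative to (P , Q), found by search
-- (a junk value when P ≡ Q).  It is abstract so that the search is never unfolded outside this block.
abstract
  orbitOf : Fin 6 × Fin 6 → Fin 6 × Fin 5
  orbitOf PQ with Fin.any? (λ o → Fin.any? (λ f → ≡-dec Fin._≟_ Fin._≟_ (rotatedRepresentative (o , f)) PQ))
  ... | yes (o , f , _) = o , f
  ... | no _ = 0F , 0F

  orbitOf-rotatedRepresentative : ∀ of → orbitOf (rotatedRepresentative of) ≡ of
  orbitOf-rotatedRepresentative (o , f) = checked o f
    where
      checked : ∀ o f → orbitOf (rotatedRepresentative (o , f)) ≡ (o , f)
      checked = from-yes (Fin.all? λ o → Fin.all? λ f →
        ≡-dec Fin._≟_ Fin._≟_ (orbitOf (rotatedRepresentative (o , f))) (o , f))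

orbit : Fin 6 × Fin 6 → Fin 6
orbit PQ = proj₁ (orbitOf PQ)

rotation : Fin 6 × Fin 6 → Fin 5
rotation PQ = proj₂ (orbitOf PQ)

rotatedRepresentatives-cover : ∀ P Q → P ≡ Q ⊎ ∃[ o ] ∃[ f ] rotatedRepresentative (o , f) ≡ (P , Q)
rotatedRepresentatives-cover = from-yes (Fin.all? λ P → Fin.all? λ Q → (P Fin.≟ Q) ⊎-dec
  Fin.any? (λ o → Fin.any? (λ f → ≡-dec Fin._≟_ Fin._≟_ (rotatedRepresentative (o , f)) (P , Q))))

rotatedRepresentative-distinct : ∀ of → proj₁ (rotatedRepresentative of) ≢ proj₂ (rotatedRepresentative of)
rotatedRepresentative-distinct (o , f) same = orbitTail≢orbitHead o (rotate-injective f same)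

rotatedRepresentative-orbitOf : ∀ {P Q} → P ≢ Q → rotatedRepresentative (orbitOf (P , Q)) ≡ (P , Q)
rotatedRepresentative-orbitOf {P} {Q} P≢Q = represented (rotatedRepresentatives-cover P Q)
  where
    open ≡-Reasoning
    represented : P ≡ Q ⊎ ∃[ o ] ∃[ f ] rotatedRepresentative (o , f) ≡ (P , Q) →
                  rotatedRepresentative (orbitOf (P , Q)) ≡ (P , Q)
    represented (inj₁ P≡Q) = ⊥-elim (P≢Q P≡Q)
    represented (inj₂ (o , f , represents)) = begin
      rotatedRepresentative (orbitOf (P , Q))                          ≡⟨ cong (rotatedRepresentative ∘ orbitOf) (sym represents) ⟩
      rotatedRepresentative (orbitOf (rotatedRepresentative (o , f)))  ≡⟨ cong rotatedRepresentative (orbitOf-rotatedRepresentative (o , f)) ⟩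
      rotatedRepresentative (o , f)                                    ≡⟨ represents ⟩
      (P , Q)                                                          ∎

rotate-pair : ∀ f {P Q} → P ≢ Q →
  (rotate f P , rotate f Q) ≡ rotatedRepresentative (orbit (P , Q) , f +₅ rotation (P , Q))
rotate-pair f {P} {Q} P≢Q = begin
  (rotate f P , rotate f Q)
    ≡⟨ cong (λ (P′ , Q′) → rotate f P′ , rotate f Q′) (sym (rotatedRepresentative-orbitOf P≢Q)) ⟩
  (rotate f (rotate ρ (orbitTail o)) , rotate f (rotate ρ (orbitHead o)))
    ≡⟨ cong₂ _,_ (rotate-+₅ f ρ (orbitTail o)) (rotate-+₅ f ρ (orbitHead o)) ⟩
  rotatedRepresentative (o , f +₅ ρ)
    ∎
  where
    open ≡-Reasoning
    o = orbit (P , Q)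
    ρ = rotation (P , Q)

orbitOf-rotate : ∀ f {P Q} → P ≢ Q → orbitOf (rotate f P , rotate f Q) ≡ (orbit (P , Q) , f +₅ rotation (P , Q))
orbitOf-rotate f {P} {Q} P≢Q =
  trans (cong orbitOf (rotate-pair f P≢Q)) (orbitOf-rotatedRepresentative (orbit (P , Q) , f +₅ rotation (P , Q)))

-- Developing a base factor

module Development (t : ℕ) .{{_ : NonZero t}} where
  open Modulo t

  Position : Set
  Position = Fin 6 × Fin t

  successor : Position → Position
  successor (j , i) = j , next i

  -- The two bijections say that the labels on
  -- each part form a complete residue system, and that every orbit of pairs of parts together with
  -- every residue is realized by exactly one step as its pair of parts and difference of labels.
  record BaseFactor : Set where
    field
      part  : Position → Fin 6
      label : Position → ℤ
      part-changes : ∀ p → part p ≢ part (successor p)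

    vertexType : Position → Fin 6 × Fin t
    vertexType p = part p , reduce (label p)

    arcType : Position → Fin 6 × Fin t
    arcType p = orbit (part p , part (successor p)) , reduce (label (successor p) - label p)

    field
      vertexType⁻¹ : Fin 6 × Fin t → Position
      vertexType⁻¹-inverseˡ : ∀ p → vertexType⁻¹ (vertexType p) ≡ p
      vertexType⁻¹-inverseʳ : ∀ v → vertexType (vertexType⁻¹ v) ≡ v
      arcType⁻¹ : Fin 6 × Fin t → Position
      arcType⁻¹-inverseˡ : ∀ p → arcType⁻¹ (arcType p) ≡ p
      arcType⁻¹-inverseʳ : ∀ a → arcType (arcType⁻¹ a) ≡ a

    baseRotation : Position → Fin 5
    baseRotation p = rotation (part p , part (successor p))

  Translation : Set
  Translation = Fin 5 × Fin t

  infixr 5 _·_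
  _·_ : Translation → Fin 6 × Fin t → Fin 6 × Fin t
  (f , c) · (P , x) = rotate f P , reduce (toℤ c + toℤ x)

  _⁻¹ : Translation → Translation
  (f , c) ⁻¹ = 0F -₅ f , reduce (- toℤ c)

  ⁻¹-· : ∀ τ v → τ ⁻¹ · τ · v ≡ v
  ⁻¹-· (f , c) (P , x) = cong₂ _,_ (unrotate-rotate f P) (reduce-unique x (begin
    toℤ (reduce (- toℤ c)) + toℤ (reduce (toℤ c + toℤ x))  ≈⟨ +-cong (reduce-≈ (- toℤ c)) (reduce-≈ (toℤ c + toℤ x)) ⟩
    - toℤ c + (toℤ c + toℤ x)                              ≡⟨ cancel (toℤ c) (toℤ x) ⟩
    toℤ x                                                  ∎))
    where
      open ≈-Reasoning
      cancel : ∀ c x → - c + (c + x) ≡ x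
      cancel = solve-∀

  ·-⁻¹ : ∀ τ v → τ · τ ⁻¹ · v ≡ v
  ·-⁻¹ (f , c) (P , x) = cong₂ _,_ (rotate-unrotate f P) (reduce-unique x (begin
    toℤ c + toℤ (reduce (toℤ (reduce (- toℤ c)) + toℤ x))  ≈⟨ +-cong (≈-refl {toℤ c}) (reduce-≈ (toℤ (reduce (- toℤ c)) + toℤ x)) ⟩
    toℤ c + (toℤ (reduce (- toℤ c)) + toℤ x)               ≈⟨ +-cong (≈-refl {toℤ c}) (+-cong (reduce-≈ (- toℤ c)) (≈-refl {toℤ x})) ⟩
    toℤ c + (- toℤ c + toℤ x)                              ≡⟨ cancel (toℤ c) (toℤ x) ⟩
    toℤ x                                                  ∎))
    where
      open ≈-Reasoning
      cancel : ∀ c x → c + (- c + x) ≡ x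
      cancel = solve-∀

  module _ (B : BaseFactor) where
    open BaseFactor B

    translate : Translation → CFactor t (K* 6 t)
    translate (f , c) = record
      { k = 6
      ; cyc = λ j i → (f , c) · vertexType (j , i)
      ; arcs = λ j i same-part → part-changes (j , i) (rotate-injective f same-part)
      ; partitionV = λ v → inverse⇒exactlyOne (λ p → (f , c) · vertexType p) (λ v → vertexType⁻¹ ((f , c) ⁻¹ · v))
          (λ p → trans (cong vertexType⁻¹ (⁻¹-· (f , c) (vertexType p))) (vertexType⁻¹-inverseˡ p)) v
          (trans (cong ((f , c) ·_) (vertexType⁻¹-inverseʳ ((f , c) ⁻¹ · v))) (·-⁻¹ (f , c) v))
      }

    arcAt : Translation → Position → (Fin 6 × Fin t) × (Fin 6 × Fin t)
    arcAt τ p = τ · vertexType p , τ · vertexType (successor p)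

    sourceOfClass : Fin 6 × Fin 5 → Fin t → Fin t → Translation × Position
    sourceOfClass (o , g) s x = (g -₅ baseRotation p , reduce (toℤ x - label p)) , p
      where p = arcType⁻¹ (o , s)

    arcSource : (Fin 6 × Fin t) × (Fin 6 × Fin t) → Translation × Position
    arcSource ((P , x) , (Q , y)) = sourceOfClass (orbitOf (P , Q)) (reduce (toℤ y - toℤ x)) x

    coordinate : Fin t → Position → Fin t
    coordinate c p = reduce (toℤ c + toℤ (reduce (label p)))

    coordinate-≈ : ∀ c p → toℤ (coordinate c p) ≈ toℤ c + label p
    coordinate-≈ c p = begin
      toℤ (coordinate c p)            ≈⟨ reduce-≈ (toℤ c + toℤ (reduce (label p))) ⟩
      toℤ c + toℤ (reduce (label p))  ≈⟨ +-cong (≈-refl {toℤ c}) (reduce-≈ (label p)) ⟩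
      toℤ c + label p                 ∎
      where open ≈-Reasoning

    coordinate-difference : ∀ c p → toℤ (coordinate c (successor p)) - toℤ (coordinate c p) ≈ label (successor p) - label p
    coordinate-difference c p = begin
      toℤ (coordinate c p⁺) - toℤ (coordinate c p)  ≈⟨ +-cong (coordinate-≈ c p⁺) (-‿cong (coordinate-≈ c p)) ⟩
      toℤ c + label p⁺ - (toℤ c + label p)          ≡⟨ cancel (toℤ c) (label p⁺) (label p) ⟩
      label p⁺ - label p                            ∎
      where
        open ≈-Reasoning
        p⁺ = successor p
        cancel : ∀ c a b → c + a - (c + b) ≡ a - b
        cancel = solve-∀

    coordinate-translation : ∀ c p → toℤ (coordinate c p) - label p ≈ toℤ c
    coordinate-translation c p = begin
      toℤ (coordinate c p) - label p  ≈⟨ +-cong (coordinate-≈ c p) (≈-refl { - label p }) ⟩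
      toℤ c + label p - label p       ≡⟨ cancel (toℤ c) (label p) ⟩
      toℤ c                           ∎
      where
        open ≈-Reasoning
        cancel : ∀ c a → c + a - a ≡ c
        cancel = solve-∀

    arcSource-arcAt : ∀ τ p → arcSource (arcAt τ p) ≡ (τ , p)
    arcSource-arcAt (f , c) p = begin
      arcSource (arcAt (f , c) p)
        ≡⟨ cong₂ (λ og s → sourceOfClass og s x) (orbitOf-rotate f (part-changes p)) (reduce-cong (coordinate-difference c p)) ⟩
      sourceOfClass (orbit (part p , part p⁺) , f +₅ baseRotation p) (reduce (label p⁺ - label p)) x
        ≡⟨ cong (λ p′ → (f +₅ baseRotation p -₅ baseRotation p′ , reduce (toℤ x - label p′)) , p′) (arcType⁻¹-inverseˡ p) ⟩
      (f +₅ baseRotation p -₅ baseRotation p , reduce (toℤ x - label p)) , p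
        ≡⟨ cong₂ (λ f′ c′ → (f′ , c′) , p) (+₅--₅ f (baseRotation p)) (reduce-unique c (coordinate-translation c p)) ⟩
      (f , c) , p
        ∎
      where
        open ≡-Reasoning
        p⁺ = successor p
        x = coordinate c p

    module ArcSource (P Q : Fin 6) (x y : Fin t) where
      o = orbit (P , Q)
      g = rotation (P , Q)
      s = reduce (toℤ y - toℤ x)
      p = arcType⁻¹ (o , s)
      p⁺ = successor p
      f = g -₅ baseRotation p
      c = reduce (toℤ x - label p)

      type-p : arcType p ≡ (o , s)
      type-p = arcType⁻¹-inverseʳ (o , s)

      parts : P ≢ Q → (rotate f (part p) , rotate f (part p⁺)) ≡ (P , Q)
      parts P≢Q = begin
        (rotate f (part p) , rotate f (part p⁺))
          ≡⟨ rotate-pair f (part-changes p) ⟩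
        rotatedRepresentative (orbit (part p , part p⁺) , f +₅ baseRotation p)
          ≡⟨ cong₂ (λ o′ g′ → rotatedRepresentative (o′ , g′)) (cong proj₁ type-p) (-₅-+₅ g (baseRotation p)) ⟩
        rotatedRepresentative (o , g)
          ≡⟨ rotatedRepresentative-orbitOf P≢Q ⟩
        (P , Q)
          ∎
        where open ≡-Reasoning

      tail-coordinate : coordinate c p ≡ x
      tail-coordinate = reduce-unique x (begin
        toℤ c + toℤ (reduce (label p))  ≈⟨ +-cong (reduce-≈ (toℤ x - label p)) (reduce-≈ (label p)) ⟩
        toℤ x - label p + label p       ≡⟨ cancel (toℤ x) (label p) ⟩
        toℤ x                           ∎)
        where
          open ≈-Reasoning
          cancel : ∀ x a → x - a + a ≡ x
          cancel = solve-∀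

      head-coordinate : coordinate c p⁺ ≡ y
      head-coordinate = reduce-unique y (begin
        toℤ c + toℤ (reduce (label p⁺))            ≈⟨ +-cong (reduce-≈ (toℤ x - label p)) (reduce-≈ (label p⁺)) ⟩
        toℤ x - label p + label p⁺                 ≡⟨ regroup (toℤ x) (label p) (label p⁺) ⟩
        toℤ x + (label p⁺ - label p)               ≈⟨ +-cong (≈-refl {toℤ x}) (≈-sym (reduce-≈ (label p⁺ - label p))) ⟩
        toℤ x + toℤ (reduce (label p⁺ - label p))  ≡⟨ cong (λ s′ → toℤ x + toℤ s′) (cong proj₂ type-p) ⟩
        toℤ x + toℤ s                              ≈⟨ +-cong (≈-refl {toℤ x}) (reduce-≈ (toℤ y - toℤ x)) ⟩
        toℤ x + (toℤ y - toℤ x)                    ≡⟨ cancel (toℤ x) (toℤ y) ⟩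
        toℤ y                                      ∎)
        where
          open ≈-Reasoning
          regroup : ∀ x a b → x - a + b ≡ x + (b - a)
          regroup = solve-∀
          cancel : ∀ x y → x + (y - x) ≡ y
          cancel = solve-∀

    arcAt-arcSource : ∀ u v → proj₁ u ≢ proj₁ v → uncurry arcAt (arcSource (u , v)) ≡ (u , v)
    arcAt-arcSource (P , x) (Q , y) P≢Q = cong₂ (λ (P′ , Q′) (x′ , y′) → (P′ , x′) , (Q′ , y′))
      (ArcSource.parts P Q x y P≢Q) (cong₂ _,_ (ArcSource.tail-coordinate P Q x y) (ArcSource.head-coordinate P Q x y))

    develop : CFactorization t (K* 6 t)
    develop = record
      { r = 5 ℕ.* t
      ; factor = translate ∘ Fin.remQuot t
      ; partitionA = λ u v u≢v → inverse⇒exactlyOne arcOf′ arcIndex arcIndex-arcOf (u , v) (arcOf-arcIndex u v u≢v)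
      }
      where
        arcOf′ : Σ (Fin (5 ℕ.* t)) (λ _ → Position) → (Fin 6 × Fin t) × (Fin 6 × Fin t)
        arcOf′ (F , p) = arcAt (Fin.remQuot t F) p
        arcIndex : (Fin 6 × Fin t) × (Fin 6 × Fin t) → Σ (Fin (5 ℕ.* t)) (λ _ → Position)
        arcIndex uv = let (τ , p) = arcSource uv in uncurry Fin.combine τ , p
        arcIndex-arcOf : ∀ q → arcIndex (arcOf′ q) ≡ q
        arcIndex-arcOf (F , p) = begin
          arcIndex (arcAt (Fin.remQuot t F) p)             ≡⟨ cong (λ (τ , p′) → uncurry Fin.combine τ , p′) (arcSource-arcAt (Fin.remQuot t F) p) ⟩
          (uncurry Fin.combine (Fin.remQuot t F) , p)      ≡⟨ cong (_, p) (Fin.combine-remQuot t F) ⟩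
          (F , p)                                          ∎
          where open ≡-Reasoning
        arcOf-arcIndex : ∀ u v → proj₁ u ≢ proj₁ v → arcOf′ (arcIndex (u , v)) ≡ (u , v)
        arcOf-arcIndex u v u≢v = begin
          arcAt (Fin.remQuot t (uncurry Fin.combine τ)) p  ≡⟨ cong (λ τ′ → arcAt τ′ p) (uncurry Fin.remQuot-combine τ) ⟩
          arcAt τ p                                        ≡⟨ arcAt-arcSource u v u≢v ⟩
          (u , v)                                          ∎
          where
            open ≡-Reasoning
            τ = proj₁ (arcSource (u , v))
            p = proj₂ (arcSource (u , v))

-- Finite enumerations, parity and orientation

record Enumeration (A : Set) (t : ℕ) : Set where
  field
    index : A → ℕ
    index< : ∀ a → index a ℕ.< t
    index-injective : ∀ a b → index a ≡ index b → a ≡ b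
    enumerate : ∀ i → i ℕ.< t → ∃[ a ] index a ≡ i

  toFin : A → Fin t
  toFin a = fromℕ< (index< a)

  fromFin : Fin t → A
  fromFin i = proj₁ (enumerate (toℕ i) (Fin.toℕ<n i))

  toℕ-toFin : ∀ a → toℕ (toFin a) ≡ index a
  toℕ-toFin a = Fin.toℕ-fromℕ< (index< a)

  index-fromFin : ∀ i → index (fromFin i) ≡ toℕ i
  index-fromFin i = proj₂ (enumerate (toℕ i) (Fin.toℕ<n i))

  fromFin-unique : ∀ {i a} → toℕ i ≡ index a → fromFin i ≡ a
  fromFin-unique {i} {a} i≡a = index-injective (fromFin i) a (trans (index-fromFin i) i≡a)

  fromFin-toFin : ∀ a → fromFin (toFin a) ≡ a
  fromFin-toFin a = fromFin-unique (toℕ-toFin a)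

  toFin-fromFin : ∀ i → toFin (fromFin i) ≡ i
  toFin-fromFin i = Fin.toℕ-injective (trans (toℕ-toFin (fromFin i)) (index-fromFin i))

data Parity : ℕ → Set where
  even : ∀ q → Parity (q ℕ.+ q)
  odd  : ∀ q → Parity (suc (q ℕ.+ q))

parity : ∀ i → Parity i
parity zero = even 0
parity (suc i) with parity i
... | even q = odd q
... | odd q = subst Parity (ℕ.+-suc (suc q) q) (even (suc q))

double-injective : ∀ {q q′} → q ℕ.+ q ≡ q′ ℕ.+ q′ → q ≡ q′
double-injective {q} {q′} eq = trans (ℕ.n≡⌊n+n/2⌋ q) (trans (cong ℕ.⌊_/2⌋ eq) (sym (ℕ.n≡⌊n+n/2⌋ q′)))

even≢odd : ∀ q q′ → q ℕ.+ q ≢ suc (q′ ℕ.+ q′)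
even≢odd zero q′ ()
even≢odd (suc q) zero eq with trans (sym (ℕ.+-suc q q)) (ℕ.suc-injective eq)
... | ()
even≢odd (suc q) (suc q′) eq = even≢odd q q′ (ℕ.suc-injective (begin
  suc (q ℕ.+ q)              ≡⟨ sym (ℕ.+-suc q q) ⟩
  q ℕ.+ suc q                ≡⟨ ℕ.suc-injective eq ⟩
  suc (q′ ℕ.+ suc q′)        ≡⟨ cong suc (ℕ.+-suc q′ q′) ⟩
  suc (suc (q′ ℕ.+ q′))      ∎))
  where open ≡-Reasoning

data Orientation : Set where
  forward backward : Orientation

orient : ∀ {N} → Orientation → Fin N → Fin N
orient forward i = i
orient backward i = Fin.opposite i

orient-involutive : ∀ {N} ω (i : Fin N) → orient ω (orient ω i) ≡ i
orient-involutive forward i = refl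
orient-involutive backward i = Fin.opposite-involutive i

toℤ-opposite : ∀ {N} (i : Fin N) → toℤ (Fin.opposite i) ≡ + N - 1ℤ - toℤ i
toℤ-opposite {N} i = begin
  toℤ (Fin.opposite i)                              ≡⟨ shuffle (toℤ (Fin.opposite i)) (toℤ i) ⟩
  toℤ (Fin.opposite i) + (1ℤ + toℤ i) - 1ℤ - toℤ i  ≡⟨ cong (λ z → z - 1ℤ - toℤ i) sum ⟩
  + N - 1ℤ - toℤ i                                  ∎
  where
    open ≡-Reasoning
    shuffle : ∀ a x → a ≡ a + (1ℤ + x) - 1ℤ - x
    shuffle = solve-∀
    sum : toℤ (Fin.opposite i) + (1ℤ + toℤ i) ≡ + N
    sum = begin
      toℤ (Fin.opposite i) + (1ℤ + toℤ i)        ≡⟨ cong (_+_ (toℤ (Fin.opposite i))) (sym (ℤ.pos-+ 1 (toℕ i))) ⟩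
      toℤ (Fin.opposite i) + + suc (toℕ i)       ≡⟨ sym (ℤ.pos-+ (toℕ (Fin.opposite i)) (suc (toℕ i))) ⟩
      + (toℕ (Fin.opposite i) ℕ.+ suc (toℕ i))   ≡⟨ cong (λ z → + (z ℕ.+ suc (toℕ i))) (Fin.opposite-prop i) ⟩
      + (N ℕ.∸ suc (toℕ i) ℕ.+ suc (toℕ i))      ≡⟨ cong +_ (ℕ.m∸n+n≡m (Fin.toℕ<n i)) ⟩
      + N                                        ∎

-- Affine forms

record Affine : Set where
  constructor affine
  field
    constant coefficientM coefficientX : ℤ

evaluate : ℤ → Affine → ℤ → ℤ
evaluate M (affine c μ ν) x = c + μ * M + ν * x

infixl 6 _⊕_ _⊖_
_⊕_ _⊖_ : Affine → Affine → Affine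
affine c μ ν ⊕ affine c′ μ′ ν′ = affine (c + c′) (μ + μ′) (ν + ν′)
affine c μ ν ⊖ affine c′ μ′ ν′ = affine (c - c′) (μ - μ′) (ν - ν′)

infixl 7 _[_]
_[_] : Affine → Affine → Affine
affine c μ ν [ affine c′ μ′ ν′ ] = affine (c + ν * c′) (μ + ν * μ′) (ν * ν′)

evaluate-⊕ : ∀ M a b x → evaluate M (a ⊕ b) x ≡ evaluate M a x + evaluate M b x
evaluate-⊕ M (affine c μ ν) (affine c′ μ′ ν′) x = lemma c μ ν c′ μ′ ν′ M x
  where
    lemma : ∀ c μ ν c′ μ′ ν′ M x →
      c + c′ + (μ + μ′) * M + (ν + ν′) * x ≡ c + μ * M + ν * x + (c′ + μ′ * M + ν′ * x)
    lemma = solve-∀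

evaluate-⊖ : ∀ M a b x → evaluate M (a ⊖ b) x ≡ evaluate M a x - evaluate M b x
evaluate-⊖ M (affine c μ ν) (affine c′ μ′ ν′) x = lemma c μ ν c′ μ′ ν′ M x
  where
    lemma : ∀ c μ ν c′ μ′ ν′ M x →
      c - c′ + (μ - μ′) * M + (ν - ν′) * x ≡ c + μ * M + ν * x - (c′ + μ′ * M + ν′ * x)
    lemma = solve-∀

evaluate-[] : ∀ M a b x → evaluate M (a [ b ]) x ≡ evaluate M a (evaluate M b x)
evaluate-[] M (affine c μ ν) (affine c′ μ′ ν′) x = lemma c μ ν c′ μ′ ν′ M x
  where
    lemma : ∀ c μ ν c′ μ′ ν′ M x →
      c + ν * c′ + (μ + ν * μ′) * M + ν * ν′ * x ≡ c + μ * M + ν * (c′ + μ′ * M + ν′ * x)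
    lemma = solve-∀

-- a ≋ b: a − b is a constant multiple of the form 1 + 2M.
IsMultiple : Affine → Set
IsMultiple (affine c μ ν) = μ ≡ c + c × ν ≡ 0ℤ

infix 4 _≋_
_≋_ : Affine → Affine → Set
a ≋ b = IsMultiple (a ⊖ b)

infix 4 _≋?_
_≋?_ : ∀ a b → Dec (a ≋ b)
a ≋? b = multiple? (a ⊖ b)
  where
    multiple? : ∀ d → Dec (IsMultiple d)
    multiple? (affine c μ ν) = (μ ℤ.≟ c + c) ×-dec (ν ℤ.≟ 0ℤ)

≋-evaluate : ∀ M a b x → a ≋ b → evaluate M a x ≡ evaluate M b x + Affine.constant (a ⊖ b) * (1ℤ + M + M)
≋-evaluate M a b x a≋b = begin
  evaluate M a x                                   ≡⟨ split (evaluate M a x) (evaluate M b x) ⟩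
  evaluate M b x + (evaluate M a x - evaluate M b x) ≡⟨ cong (_+_ (evaluate M b x)) (sym (evaluate-⊖ M a b x)) ⟩
  evaluate M b x + evaluate M (a ⊖ b) x            ≡⟨ cong (_+_ (evaluate M b x)) (multiple (a ⊖ b) a≋b) ⟩
  evaluate M b x + Affine.constant (a ⊖ b) * (1ℤ + M + M) ∎
  where
    open ≡-Reasoning
    split : ∀ a b → a ≡ b + (a - b)
    split = solve-∀
    multiple : ∀ d → IsMultiple d → evaluate M d x ≡ Affine.constant d * (1ℤ + M + M)
    multiple (affine c _ _) (refl , refl) = lemma c M x
      where
        lemma : ∀ c M x → c + (c + c) * M + 0ℤ * x ≡ c * (1ℤ + M + M)
        lemma = solve-∀

-- The base factor for t = 2m + 1, m = n + 1

module Construction (n : ℕ) where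

  m t : ℕ
  m = suc n
  t = suc (m ℕ.+ m)

  open Modulo t
  open Development t

  M : ℤ
  M = + m

  M≡1+n : M ≡ 1ℤ + + n
  M≡1+n = ℤ.pos-+ 1 n

  ⟦_⟧ : Affine → ℤ → ℤ
  ⟦_⟧ = evaluate M

  ≋⇒≈ : ∀ a b x → a ≋ b → ⟦ a ⟧ x ≈ ⟦ b ⟧ x
  ≋⇒≈ a b x a≋b = multiple (Affine.constant (a ⊖ b))
    (trans (≋-evaluate M a b x a≋b) (cong (λ T → ⟦ b ⟧ x + Affine.constant (a ⊖ b) * T) modulus))
    where
      modulus : 1ℤ + M + M ≡ + t
      modulus = begin
        1ℤ + M + M          ≡⟨ ℤ.+-assoc 1ℤ M M ⟩
        1ℤ + (M + M)        ≡⟨ cong (_+_ 1ℤ) (sym (ℤ.pos-+ m m)) ⟩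
        1ℤ + + (m ℕ.+ m)    ≡⟨ sym (ℤ.pos-+ 1 (m ℕ.+ m)) ⟩
        + t                 ∎
        where open ≡-Reasoning

  difference-≈ : ∀ a b c d x → a ⊖ b ≋ c ⊕ d → ⟦ a ⟧ x - ⟦ b ⟧ x ≈ ⟦ c ⟧ x + ⟦ d ⟧ x
  difference-≈ a b c d x forms = begin
    ⟦ a ⟧ x - ⟦ b ⟧ x   ≡⟨ sym (evaluate-⊖ M a b x) ⟩
    ⟦ a ⊖ b ⟧ x         ≈⟨ ≋⇒≈ (a ⊖ b) (c ⊕ d) x forms ⟩
    ⟦ c ⊕ d ⟧ x         ≡⟨ evaluate-⊕ M c d x ⟩
    ⟦ c ⟧ x + ⟦ d ⟧ x   ∎
    where open ≈-Reasoning

  zeroForm lastForm : Affine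
  zeroForm = affine 0ℤ 0ℤ 0ℤ
  lastForm = affine -1ℤ 1ℤ 0ℤ

  ⟦[zeroForm]⟧ : ∀ a x → ⟦ a [ zeroForm ] ⟧ x ≡ ⟦ a ⟧ 0ℤ
  ⟦[zeroForm]⟧ a x = trans (evaluate-[] M a zeroForm x) (cong ⟦ a ⟧ (vanish M x))
    where
      vanish : ∀ M x → 0ℤ + 0ℤ * M + 0ℤ * x ≡ 0ℤ
      vanish = solve-∀

  toℤ-fromℕ : toℤ (Fin.fromℕ n) ≡ ⟦ lastForm ⟧ 0ℤ
  toℤ-fromℕ = begin
    + toℕ (Fin.fromℕ n)     ≡⟨ cong +_ (Fin.toℕ-fromℕ n) ⟩
    + n                      ≡⟨ lemma (+ n) ⟩
    -1ℤ + 1ℤ * (1ℤ + + n) + 0ℤ * 0ℤ  ≡⟨ cong (λ z → -1ℤ + 1ℤ * z + 0ℤ * 0ℤ) (sym M≡1+n) ⟩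
    ⟦ lastForm ⟧ 0ℤ          ∎
    where
      open ≡-Reasoning
      lemma : ∀ a → a ≡ -1ℤ + 1ℤ * (1ℤ + a) + 0ℤ * 0ℤ
      lemma = solve-∀

  succForm : Affine
  succForm = affine 1ℤ 0ℤ 1ℤ

  toℤ-suc : ∀ {N} (i : Fin N) → toℤ (Fin.suc i) ≡ ⟦ succForm ⟧ (toℤ i)
  toℤ-suc i = trans (ℤ.pos-+ 1 (toℕ i)) (lemma (toℤ i) M)
    where
      lemma : ∀ x M → 1ℤ + x ≡ 1ℤ + 0ℤ * M + 1ℤ * x
      lemma = solve-∀

  orientationForm : Affine → Orientation → Affine
  orientationForm _ forward = affine 0ℤ 0ℤ 1ℤ
  orientationForm opposite backward = opposite

  toℤ-orient : ∀ {N} (oppositeForm : Affine) → (∀ (i : Fin N) → toℤ (Fin.opposite i) ≡ ⟦ oppositeForm ⟧ (toℤ i)) →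
               ∀ ω (i : Fin N) → toℤ (orient ω i) ≡ ⟦ orientationForm oppositeForm ω ⟧ (toℤ i)
  toℤ-orient _ _ forward i = lemma (toℤ i) M
    where
      lemma : ∀ x M → x ≡ 0ℤ + 0ℤ * M + 1ℤ * x
      lemma = solve-∀
  toℤ-orient _ toℤ-opposite′ backward i = toℤ-opposite′ i

  oppositeₘ oppositeₙ : Affine
  oppositeₘ = affine -1ℤ 1ℤ -1ℤ
  oppositeₙ = affine (- + 2) 1ℤ -1ℤ

  toℤ-oppositeₘ : ∀ (i : Fin m) → toℤ (Fin.opposite i) ≡ ⟦ oppositeₘ ⟧ (toℤ i)
  toℤ-oppositeₘ i = trans (toℤ-opposite i) (lemma M (toℤ i))
    where
      lemma : ∀ M x → M - 1ℤ - x ≡ -1ℤ + 1ℤ * M + -1ℤ * x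
      lemma = solve-∀

  toℤ-oppositeₙ : ∀ (i : Fin n) → toℤ (Fin.opposite i) ≡ ⟦ oppositeₙ ⟧ (toℤ i)
  toℤ-oppositeₙ i = begin
    toℤ (Fin.opposite i)              ≡⟨ toℤ-opposite i ⟩
    + n - 1ℤ - toℤ i                  ≡⟨ lemma (+ n) (toℤ i) ⟩
    - + 2 + 1ℤ * (1ℤ + + n) + -1ℤ * toℤ i ≡⟨ cong (λ z → - + 2 + 1ℤ * z + -1ℤ * toℤ i) (sym M≡1+n) ⟩
    ⟦ oppositeₙ ⟧ (toℤ i)              ∎
    where
      open ≡-Reasoning
      lemma : ∀ a x → a - 1ℤ - x ≡ - + 2 + 1ℤ * (1ℤ + a) + -1ℤ * x
      lemma = solve-∀

  data Side : Set where
    tail head : Side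

  _≟ˢ_ : DecidableEquality Side
  tail ≟ˢ tail = yes refl
  head ≟ˢ head = yes refl
  tail ≟ˢ head = no λ ()
  head ≟ˢ tail = no λ ()

  data Stage : Set where
    at : Side → Fin m → Stage
    final : Stage

  stageIndex : Stage → ℕ
  stageIndex (at tail k) = toℕ k ℕ.+ toℕ k
  stageIndex (at head k) = suc (toℕ k ℕ.+ toℕ k)
  stageIndex final = m ℕ.+ m

  stageIndex< : ∀ p → stageIndex p ℕ.< t
  stageIndex< (at tail k) = ℕ.m<n⇒m<1+n (ℕ.+-mono-< (Fin.toℕ<n k) (Fin.toℕ<n k))
  stageIndex< (at head k) = ℕ.s≤s (ℕ.+-mono-< (Fin.toℕ<n k) (Fin.toℕ<n k))
  stageIndex< final = ℕ.n<1+n (m ℕ.+ m)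

  stageIndex-injective : ∀ p q → stageIndex p ≡ stageIndex q → p ≡ q
  stageIndex-injective (at tail k) (at tail k′) eq = cong (at tail) (Fin.toℕ-injective (double-injective eq))
  stageIndex-injective (at head k) (at head k′) eq = cong (at head) (Fin.toℕ-injective (double-injective (ℕ.suc-injective eq)))
  stageIndex-injective (at tail k) (at head k′) eq = ⊥-elim (even≢odd (toℕ k) (toℕ k′) eq)
  stageIndex-injective (at head k) (at tail k′) eq = ⊥-elim (even≢odd (toℕ k′) (toℕ k) (sym eq))
  stageIndex-injective (at tail k) final eq = ⊥-elim (ℕ.<-irrefl (double-injective eq) (Fin.toℕ<n k))
  stageIndex-injective final (at tail k) eq = ⊥-elim (ℕ.<-irrefl (double-injective (sym eq)) (Fin.toℕ<n k))
  stageIndex-injective (at head k) final eq = ⊥-elim (even≢odd m (toℕ k) (sym eq))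
  stageIndex-injective final (at head k) eq = ⊥-elim (even≢odd m (toℕ k) eq)
  stageIndex-injective final final _ = refl

  stageWithIndex : ∀ i → i ℕ.< t → ∃[ p ] stageIndex p ≡ i
  stageWithIndex i i<t with parity i
  ... | even q with q ℕ.<? m
  ...   | yes q<m = at tail (fromℕ< q<m) , cong₂ ℕ._+_ (Fin.toℕ-fromℕ< q<m) (Fin.toℕ-fromℕ< q<m)
  ...   | no q≮m = final , cong (λ z → z ℕ.+ z) (sym q≡m)
    where
      halve : q ℕ.+ q ℕ.≤ m ℕ.+ m → q ℕ.≤ m
      halve le = subst₂ ℕ._≤_ (sym (ℕ.n≡⌊n+n/2⌋ q)) (sym (ℕ.n≡⌊n+n/2⌋ m)) (ℕ.⌊n/2⌋-mono le)
      q≡m : q ≡ m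
      q≡m = ℕ.≤-antisym (halve (ℕ.≤-pred i<t)) (ℕ.≮⇒≥ q≮m)
  stageWithIndex i i<t | odd q = at head (fromℕ< q<m) , cong (λ z → suc (z ℕ.+ z)) (Fin.toℕ-fromℕ< q<m)
    where
      q<m : q ℕ.< m
      q<m = ℕ.≰⇒> λ m≤q → ℕ.<⇒≱ (ℕ.≤-pred i<t) (ℕ.+-mono-≤ m≤q m≤q)

  stageEnumeration : Enumeration Stage t
  stageEnumeration = record
    { index = stageIndex
    ; index< = stageIndex<
    ; index-injective = stageIndex-injective
    ; enumerate = stageWithIndex
    }

  data Extreme : Set where
    bottom top : Extreme

  _≟ᵉ_ : DecidableEquality Extreme
  bottom ≟ᵉ bottom = yes refl
  top ≟ᵉ top = yes refl
  bottom ≟ᵉ top = no λ ()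
  top ≟ᵉ bottom = no λ ()

  data Difference : Set where
    evenD : Fin m → Difference
    oddD : Fin n → Difference
    extremeD : Extreme → Difference

  differenceIndex : Difference → ℕ
  differenceIndex (evenD k) = suc (toℕ k) ℕ.+ suc (toℕ k)
  differenceIndex (oddD j) = suc (toℕ j ℕ.+ toℕ j)
  differenceIndex (extremeD bottom) = 0
  differenceIndex (extremeD top) = suc (n ℕ.+ n)

  differenceIndex< : ∀ d → differenceIndex d ℕ.< t
  differenceIndex< (evenD k) = ℕ.s≤s (ℕ.+-mono-≤ (Fin.toℕ<n k) (Fin.toℕ<n k))
  differenceIndex< (oddD j) = ℕ.<-trans (ℕ.s≤s (ℕ.+-mono-< (Fin.toℕ<n j) (Fin.toℕ<n j))) (differenceIndex< (extremeD top))
  differenceIndex< (extremeD bottom) = ℕ.z<s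
  differenceIndex< (extremeD top) = ℕ.s≤s (ℕ.s≤s (ℕ.+-monoʳ-≤ n (ℕ.n≤1+n n)))

  differenceIndex-injective : ∀ d e → differenceIndex d ≡ differenceIndex e → d ≡ e
  differenceIndex-injective (evenD k) (evenD k′) eq = cong evenD (Fin.toℕ-injective (ℕ.suc-injective (double-injective eq)))
  differenceIndex-injective (oddD j) (oddD j′) eq = cong oddD (Fin.toℕ-injective (double-injective (ℕ.suc-injective eq)))
  differenceIndex-injective (extremeD bottom) (extremeD bottom) _ = refl
  differenceIndex-injective (extremeD top) (extremeD top) _ = refl
  differenceIndex-injective (evenD k) (oddD j) eq = ⊥-elim (even≢odd (suc (toℕ k)) (toℕ j) eq)
  differenceIndex-injective (oddD j) (evenD k) eq = ⊥-elim (even≢odd (suc (toℕ k)) (toℕ j) (sym eq))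
  differenceIndex-injective (evenD k) (extremeD top) eq = ⊥-elim (even≢odd (suc (toℕ k)) n eq)
  differenceIndex-injective (extremeD top) (evenD k) eq = ⊥-elim (even≢odd (suc (toℕ k)) n (sym eq))
  differenceIndex-injective (oddD j) (extremeD top) eq =
    ⊥-elim (ℕ.<-irrefl (double-injective (ℕ.suc-injective eq)) (Fin.toℕ<n j))
  differenceIndex-injective (extremeD top) (oddD j) eq =
    ⊥-elim (ℕ.<-irrefl (double-injective (ℕ.suc-injective (sym eq))) (Fin.toℕ<n j))
  differenceIndex-injective (evenD _) (extremeD bottom) ()
  differenceIndex-injective (oddD _) (extremeD bottom) ()
  differenceIndex-injective (extremeD bottom) (evenD _) ()
  differenceIndex-injective (extremeD bottom) (oddD _) ()
  differenceIndex-injective (extremeD bottom) (extremeD top) ()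
  differenceIndex-injective (extremeD top) (extremeD bottom) ()

  differenceWithIndex : ∀ i → i ℕ.< t → ∃[ d ] differenceIndex d ≡ i
  differenceWithIndex i i<t with parity i
  ... | even zero = extremeD bottom , refl
  ... | even (suc q) = evenD (fromℕ< q<m) , cong (λ z → suc z ℕ.+ suc z) (Fin.toℕ-fromℕ< q<m)
    where
      q<m : q ℕ.< m
      q<m = ℕ.≰⇒> λ m≤q → ℕ.<⇒≱ i<t (ℕ.s≤s (ℕ.+-mono-≤ m≤q (ℕ.m≤n⇒m≤1+n m≤q)))
  ... | odd q with q ℕ.<? n
  ...   | yes q<n = oddD (fromℕ< q<n) , cong (λ z → suc (z ℕ.+ z)) (Fin.toℕ-fromℕ< q<n)
  ...   | no q≮n = extremeD top , cong (λ z → suc (z ℕ.+ z)) (sym q≡n)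
    where
      q≡n : q ≡ n
      q≡n = ℕ.≤-antisym (ℕ.≤-pred (ℕ.≰⇒> λ m≤q → ℕ.<⇒≱ (ℕ.≤-pred i<t) (ℕ.+-mono-≤ m≤q m≤q))) (ℕ.≮⇒≥ q≮n)

  differenceEnumeration : Enumeration Difference t
  differenceEnumeration = record
    { index = differenceIndex
    ; index< = differenceIndex<
    ; index-injective = differenceIndex-injective
    ; enumerate = differenceWithIndex
    }

  data Half : Set where
    lower upper : Half

  _≟ʰ_ : DecidableEquality Half
  lower ≟ʰ lower = yes refl
  upper ≟ʰ upper = yes refl
  lower ≟ʰ upper = no λ ()
  upper ≟ʰ lower = no λ ()

  data Block : Set where
    origin : Block
    inHalf : Half → Fin m → Block

  blockIndex : Block → ℕ
  blockIndex origin = 0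
  blockIndex (inHalf lower k) = suc (toℕ k)
  blockIndex (inHalf upper k) = suc (m ℕ.+ toℕ k)

  blockIndex< : ∀ b → blockIndex b ℕ.< t
  blockIndex< origin = ℕ.z<s
  blockIndex< (inHalf lower k) = ℕ.s≤s (ℕ.≤-trans (Fin.toℕ<n k) (ℕ.m≤m+n m m))
  blockIndex< (inHalf upper k) = ℕ.s≤s (ℕ.+-monoʳ-< m (Fin.toℕ<n k))

  blockIndex-injective : ∀ b c → blockIndex b ≡ blockIndex c → b ≡ c
  blockIndex-injective origin origin _ = refl
  blockIndex-injective (inHalf lower k) (inHalf lower k′) eq = cong (inHalf lower) (Fin.toℕ-injective (ℕ.suc-injective eq))
  blockIndex-injective (inHalf upper k) (inHalf upper k′) eq =
    cong (inHalf upper) (Fin.toℕ-injective (ℕ.+-cancelˡ-≡ m _ _ (ℕ.suc-injective eq)))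
  blockIndex-injective (inHalf lower k) (inHalf upper k′) eq =
    ⊥-elim (ℕ.<⇒≱ (Fin.toℕ<n k) (subst (m ℕ.≤_) (sym (ℕ.suc-injective eq)) (ℕ.m≤m+n m _)))
  blockIndex-injective (inHalf upper k) (inHalf lower k′) eq =
    ⊥-elim (ℕ.<⇒≱ (Fin.toℕ<n k′) (subst (m ℕ.≤_) (ℕ.suc-injective eq) (ℕ.m≤m+n m _)))
  blockIndex-injective origin (inHalf lower _) ()
  blockIndex-injective origin (inHalf upper _) ()
  blockIndex-injective (inHalf lower _) origin ()
  blockIndex-injective (inHalf upper _) origin ()

  blockWithIndex : ∀ i → i ℕ.< t → ∃[ b ] blockIndex b ≡ i
  blockWithIndex zero _ = origin , refl
  blockWithIndex (suc i) i<t with i ℕ.<? m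
  ... | yes i<m = inHalf lower (fromℕ< i<m) , cong suc (Fin.toℕ-fromℕ< i<m)
  ... | no i≮m = inHalf upper (fromℕ< d<m) , cong suc (trans (cong (m ℕ.+_) (Fin.toℕ-fromℕ< d<m)) (ℕ.m+[n∸m]≡n m≤i))
    where
      m≤i = ℕ.≮⇒≥ i≮m
      d<m : i ℕ.∸ m ℕ.< m
      d<m = ℕ.+-cancelˡ-< m _ _ (subst (ℕ._< m ℕ.+ m) (sym (ℕ.m+[n∸m]≡n m≤i)) (ℕ.≤-pred i<t))

  blockEnumeration : Enumeration Block t
  blockEnumeration = record
    { index = blockIndex
    ; index< = blockIndex<
    ; index-injective = blockIndex-injective
    ; enumerate = blockWithIndex
    }

  module Stages = Enumeration stageEnumeration
  module Differences = Enumeration differenceEnumeration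
  module Blocks = Enumeration blockEnumeration

  afterHead : ∀ {k : Fin m} → View k → Stage
  afterHead (‵inject₁ i) = at tail (Fin.suc i)
  afterHead ‵fromℕ = final

  succ : Stage → Stage
  succ (at tail k) = at head k
  succ (at head k) = afterHead (view k)
  succ final = at tail 0F

  index-succ : ∀ p → suc (Stages.index p) ℕ.% t ≡ Stages.index (succ p)
  index-succ (at tail k) = DM.m<n⇒m%n≡m (Stages.index< (at head k))
  index-succ (at head k) = after (view k)
    where
      after : ∀ {k} (v : View k) → suc (Stages.index (at head k)) ℕ.% t ≡ Stages.index (afterHead v)
      after (‵inject₁ i) = begin
        suc (suc (toℕ (Fin.inject₁ i) ℕ.+ toℕ (Fin.inject₁ i))) ℕ.% t  ≡⟨ cong (λ z → suc (suc (z ℕ.+ z)) ℕ.% t) (Fin.toℕ-inject₁ i) ⟩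
        suc (suc (toℕ i ℕ.+ toℕ i)) ℕ.% t                              ≡⟨ cong (λ z → suc z ℕ.% t) (sym (ℕ.+-suc (toℕ i) (toℕ i))) ⟩
        Stages.index (at tail (Fin.suc i)) ℕ.% t                        ≡⟨ DM.m<n⇒m%n≡m (Stages.index< (at tail (Fin.suc i))) ⟩
        Stages.index (at tail (Fin.suc i))                              ∎
        where open ≡-Reasoning
      after ‵fromℕ = begin
        suc (suc (toℕ (Fin.fromℕ n) ℕ.+ toℕ (Fin.fromℕ n))) ℕ.% t  ≡⟨ cong (λ z → suc (suc (z ℕ.+ z)) ℕ.% t) (Fin.toℕ-fromℕ n) ⟩
        suc (suc (n ℕ.+ n)) ℕ.% t                                  ≡⟨ cong (λ z → suc z ℕ.% t) (sym (ℕ.+-suc n n)) ⟩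
        (m ℕ.+ m) ℕ.% t                                            ≡⟨ DM.m<n⇒m%n≡m (Stages.index< final) ⟩
        m ℕ.+ m                                                    ∎
        where open ≡-Reasoning
  index-succ final = DM.n%n≡0 t

  fromFin-next : ∀ i → Stages.fromFin (next i) ≡ succ (Stages.fromFin i)
  fromFin-next i = Stages.fromFin-unique (begin
    toℕ (next i)                             ≡⟨ Fin.toℕ-fromℕ< (DM.m%n<n (suc (toℕ i)) t) ⟩
    suc (toℕ i) ℕ.% t                        ≡⟨ cong (λ z → suc z ℕ.% t) (sym (Stages.index-fromFin i)) ⟩
    suc (Stages.index (Stages.fromFin i)) ℕ.% t ≡⟨ index-succ (Stages.fromFin i) ⟩
    Stages.index (succ (Stages.fromFin i))   ∎)
    where open ≡-Reasoning

  -- Base cycle j visits part sidePart tail j at the positions 2k and part sidePart head j at the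
  -- positions 2k + 1, with labels sideLabel tail j and sideLabel head j evaluated at k, and part
  -- finalPart j at position 2m.  Its tail-to-head steps realize orbit j, its head-to-tail steps
  -- orbit partner j, and its two steps through position 2m are the corner steps.
  sidePart : Side → Fin 6 → Fin 6
  sidePart tail = orbitTail
  sidePart head = orbitHead

  finalPart : Fin 6 → Fin 6
  finalPart 0F = 2F
  finalPart 1F = 1F
  finalPart 2F = 5F
  finalPart 3F = 4F
  finalPart 4F = 3F
  finalPart 5F = 0F

  half : Fin 6 → Half
  half 0F = lower
  half 1F = upper
  half 2F = lower
  half 3F = lower
  half 4F = upper
  half 5F = upper

  -- Whether a block index runs with k or against it; a step's difference always runs the same way as
  -- the block index of the step's target.
  orientation : Side → Half → Orientation
  orientation tail lower = backward
  orientation tail upper = forward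
  orientation head lower = forward
  orientation head upper = backward

  sideLabel : Side → Fin 6 → Affine
  sideLabel tail 0F = affine 0ℤ 1ℤ -1ℤ
  sideLabel tail 1F = affine 1ℤ 1ℤ 1ℤ
  sideLabel tail 2F = affine 0ℤ 1ℤ -1ℤ
  sideLabel tail 3F = affine 1ℤ 1ℤ -1ℤ
  sideLabel tail 4F = affine (+ 2) 1ℤ 1ℤ
  sideLabel tail 5F = affine (+ 2) 1ℤ 1ℤ
  sideLabel head 0F = affine (+ 3) 0ℤ 1ℤ
  sideLabel head 1F = affine 0ℤ (+ 2) -1ℤ
  sideLabel head 2F = affine (+ 2) 0ℤ 1ℤ
  sideLabel head 3F = affine (+ 3) 0ℤ 1ℤ
  sideLabel head 4F = affine (+ 2) (+ 2) -1ℤ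
  sideLabel head 5F = affine (+ 2) (+ 2) -1ℤ

  finalLabel : Fin 6 → Affine
  finalLabel 0F = affine (+ 2) 0ℤ 0ℤ
  finalLabel 1F = affine (+ 2) 0ℤ 0ℤ
  finalLabel 2F = affine 0ℤ 0ℤ 0ℤ
  finalLabel 3F = affine 0ℤ 0ℤ 0ℤ
  finalLabel 4F = affine 1ℤ 0ℤ 0ℤ
  finalLabel 5F = affine 1ℤ 0ℤ 0ℤ

  -- The labels on part P are offset P plus the residues 0, …, 2m, and the steps in orbit o have label
  -- differences shift o plus the residues 0, …, 2m.
  offsetForm : Fin 6 → Affine
  offsetForm 0F = affine 1ℤ 0ℤ 0ℤ
  offsetForm 1F = affine (+ 2) 0ℤ 0ℤ
  offsetForm 2F = affine (+ 2) 0ℤ 0ℤ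
  offsetForm 3F = affine 1ℤ 0ℤ 0ℤ
  offsetForm 4F = affine 0ℤ 0ℤ 0ℤ
  offsetForm 5F = affine 0ℤ 0ℤ 0ℤ

  shiftForm : Fin 6 → Affine
  shiftForm 0F = affine 1ℤ -1ℤ 0ℤ
  shiftForm 1F = affine -1ℤ -1ℤ 0ℤ
  shiftForm _ = affine 0ℤ -1ℤ 0ℤ

  blockForm : Half → Affine
  blockForm lower = affine 1ℤ 0ℤ 1ℤ
  blockForm upper = affine 1ℤ 1ℤ 1ℤ

  evenForm oddForm : Affine
  evenForm = affine (+ 2) 0ℤ (+ 2)
  oddForm = affine 1ℤ 0ℤ (+ 2)

  extremeForm : Extreme → Affine
  extremeForm bottom = affine 0ℤ 0ℤ 0ℤ
  extremeForm top = affine -1ℤ (+ 2) 0ℤ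

  partner : Fin 6 → Fin 6
  partner 0F = 1F
  partner 1F = 0F
  partner 2F = 3F
  partner 3F = 2F
  partner 4F = 5F
  partner 5F = 4F

  partnerRotation : Fin 6 → Fin 5
  partnerRotation 0F = 2F
  partnerRotation 1F = 3F
  partnerRotation 2F = 2F
  partnerRotation 3F = 3F
  partnerRotation 4F = 4F
  partnerRotation 5F = 1F

  data Corner : Set where
    intoFinal outOfFinal : Corner

  _≟ᶜ_ : DecidableEquality Corner
  intoFinal ≟ᶜ intoFinal = yes refl
  outOfFinal ≟ᶜ outOfFinal = yes refl
  intoFinal ≟ᶜ outOfFinal = no λ ()
  outOfFinal ≟ᶜ intoFinal = no λ ()

  corner : Fin 6 → Corner → Fin 6 × Fin 5 × Extreme
  corner 0F intoFinal = 2F , 2F , bottom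
  corner 1F intoFinal = 0F , 0F , bottom
  corner 2F intoFinal = 1F , 1F , bottom
  corner 3F intoFinal = 4F , 2F , top
  corner 4F intoFinal = 2F , 3F , top
  corner 5F intoFinal = 3F , 3F , top
  corner 0F outOfFinal = 1F , 3F , top
  corner 1F outOfFinal = 5F , 3F , top
  corner 2F outOfFinal = 0F , 3F , top
  corner 3F outOfFinal = 3F , 1F , bottom
  corner 4F outOfFinal = 4F , 3F , bottom
  corner 5F outOfFinal = 5F , 2F , bottom

  cornerSource : Fin 6 → Extreme → Fin 6 × Corner
  cornerSource 0F bottom = 1F , intoFinal
  cornerSource 1F bottom = 2F , intoFinal
  cornerSource 2F bottom = 0F , intoFinal
  cornerSource 3F bottom = 3F , outOfFinal
  cornerSource 4F bottom = 4F , outOfFinal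
  cornerSource 5F bottom = 5F , outOfFinal
  cornerSource 0F top = 2F , outOfFinal
  cornerSource 1F top = 0F , outOfFinal
  cornerSource 2F top = 4F , intoFinal
  cornerSource 3F top = 5F , intoFinal
  cornerSource 4F top = 3F , intoFinal
  cornerSource 5F top = 1F , outOfFinal

  owner : Fin 6 → Half → Fin 6 × Side
  owner 0F lower = 2F , head
  owner 1F lower = 0F , head
  owner 2F lower = 3F , head
  owner 3F lower = 3F , tail
  owner 4F lower = 2F , tail
  owner 5F lower = 0F , tail
  owner 0F upper = 4F , tail
  owner 1F upper = 5F , head
  owner 2F upper = 4F , head
  owner 3F upper = 5F , tail
  owner 4F upper = 1F , tail
  owner 5F upper = 1F , head

  finalOwner : Fin 6 → Fin 6
  finalOwner 0F = 5F
  finalOwner 1F = 1F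
  finalOwner 2F = 0F
  finalOwner 3F = 4F
  finalOwner 4F = 3F
  finalOwner 5F = 2F

  partAt : Fin 6 → Stage → Fin 6
  partAt j (at s _) = sidePart s j
  partAt j final = finalPart j

  labelAt : Fin 6 → Stage → ℤ
  labelAt j (at s k) = ⟦ sideLabel s j ⟧ (toℤ k)
  labelAt j final = ⟦ finalLabel j ⟧ 0ℤ

  blockAt : Fin 6 → Stage → Block
  blockAt j (at s k) = inHalf (half j) (orient (orientation s (half j)) k)
  blockAt j final = origin

  offset : Fin 6 → ℤ
  offset P = ⟦ offsetForm P ⟧ 0ℤ

  cellOf : Fin 6 → Block → Fin 6 × Stage
  cellOf P origin = finalOwner P , final
  cellOf P (inHalf h k) = let (j , s) = owner P h in j , at s (orient (orientation s h) k)

  owner-sidePart : ∀ s j → owner (sidePart s j) (half j) ≡ (j , s)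
  owner-sidePart tail = from-yes (Fin.all? λ j → ≡-dec Fin._≟_ _≟ˢ_ (owner (sidePart tail j) (half j)) (j , tail))
  owner-sidePart head = from-yes (Fin.all? λ j → ≡-dec Fin._≟_ _≟ˢ_ (owner (sidePart head j) (half j)) (j , head))

  sidePart-owner : ∀ P h → let (j , s) = owner P h in sidePart s j ≡ P × half j ≡ h
  sidePart-owner P lower = checked P
    where
      checked : ∀ P → let (j , s) = owner P lower in sidePart s j ≡ P × half j ≡ lower
      checked = from-yes (Fin.all? λ P → let (j , s) = owner P lower in (sidePart s j Fin.≟ P) ×-dec (half j ≟ʰ lower))
  sidePart-owner P upper = checked P
    where
      checked : ∀ P → let (j , s) = owner P upper in sidePart s j ≡ P × half j ≡ upper
      checked = from-yes (Fin.all? λ P → let (j , s) = owner P upper in (sidePart s j Fin.≟ P) ×-dec (half j ≟ʰ upper))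

  finalOwner-finalPart : ∀ j → finalOwner (finalPart j) ≡ j
  finalOwner-finalPart = from-yes (Fin.all? λ j → finalOwner (finalPart j) Fin.≟ j)

  finalPart-finalOwner : ∀ P → finalPart (finalOwner P) ≡ P
  finalPart-finalOwner = from-yes (Fin.all? λ P → finalPart (finalOwner P) Fin.≟ P)

  cellOf-vertex : ∀ j p → cellOf (partAt j p) (blockAt j p) ≡ (j , p)
  cellOf-vertex j (at s k) = begin
    cellOf (sidePart s j) (inHalf (half j) (orient ω k))
      ≡⟨ cong (λ (j′ , s′) → j′ , at s′ (orient (orientation s′ (half j)) (orient ω k))) (owner-sidePart s j) ⟩
    j , at s (orient ω (orient ω k))
      ≡⟨ cong (λ k′ → j , at s k′) (orient-involutive ω k) ⟩
    j , at s k
      ∎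
    where
      open ≡-Reasoning
      ω = orientation s (half j)
  cellOf-vertex j final = cong (_, final) (finalOwner-finalPart j)

  vertex-cellOf : ∀ P b → let (j , p) = cellOf P b in (partAt j p , blockAt j p) ≡ (P , b)
  vertex-cellOf P origin = cong (_, origin) (finalPart-finalOwner P)
  vertex-cellOf P (inHalf h k) = cong₂ _,_ (proj₁ (sidePart-owner P h)) (realign (proj₂ (sidePart-owner P h)))
    where
      s = proj₂ (owner P h)
      realign : ∀ {h′} → h′ ≡ h → inHalf h′ (orient (orientation s h′) (orient (orientation s h) k)) ≡ inHalf h k
      realign refl = cong (inHalf h) (orient-involutive (orientation s h) k)

  index-inHalf : ∀ h k → + Blocks.index (inHalf h k) ≡ ⟦ blockForm h ⟧ (toℤ k)
  index-inHalf lower k = trans (ℤ.pos-+ 1 (toℕ k)) (lemma M (toℤ k))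
    where
      lemma : ∀ M x → 1ℤ + x ≡ 1ℤ + 0ℤ * M + 1ℤ * x
      lemma = solve-∀
  index-inHalf upper k = begin
    + suc (m ℕ.+ toℕ k)    ≡⟨ ℤ.pos-+ 1 (m ℕ.+ toℕ k) ⟩
    1ℤ + + (m ℕ.+ toℕ k)   ≡⟨ cong (_+_ 1ℤ) (ℤ.pos-+ m (toℕ k)) ⟩
    1ℤ + (M + toℤ k)       ≡⟨ lemma M (toℤ k) ⟩
    ⟦ blockForm upper ⟧ (toℤ k) ∎
    where
      open ≡-Reasoning
      lemma : ∀ M x → 1ℤ + (M + x) ≡ 1ℤ + 1ℤ * M + 1ℤ * x
      lemma = solve-∀

  index-evenD : ∀ k → + Differences.index (evenD k) ≡ ⟦ evenForm ⟧ (toℤ k)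
  index-evenD k = begin
    + (suc (toℕ k) ℕ.+ suc (toℕ k))   ≡⟨ ℤ.pos-+ (suc (toℕ k)) (suc (toℕ k)) ⟩
    + suc (toℕ k) + + suc (toℕ k)     ≡⟨ cong₂ _+_ (ℤ.pos-+ 1 (toℕ k)) (ℤ.pos-+ 1 (toℕ k)) ⟩
    1ℤ + toℤ k + (1ℤ + toℤ k)         ≡⟨ lemma M (toℤ k) ⟩
    ⟦ evenForm ⟧ (toℤ k)              ∎
    where
      open ≡-Reasoning
      lemma : ∀ M x → 1ℤ + x + (1ℤ + x) ≡ + 2 + 0ℤ * M + + 2 * x
      lemma = solve-∀

  index-oddD : ∀ j → + Differences.index (oddD j) ≡ ⟦ oddForm ⟧ (toℤ j)
  index-oddD j = begin
    + suc (toℕ j ℕ.+ toℕ j)   ≡⟨ ℤ.pos-+ 1 (toℕ j ℕ.+ toℕ j) ⟩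
    1ℤ + + (toℕ j ℕ.+ toℕ j)  ≡⟨ cong (_+_ 1ℤ) (ℤ.pos-+ (toℕ j) (toℕ j)) ⟩
    1ℤ + (toℤ j + toℤ j)      ≡⟨ lemma M (toℤ j) ⟩
    ⟦ oddForm ⟧ (toℤ j)       ∎
    where
      open ≡-Reasoning
      lemma : ∀ M x → 1ℤ + (x + x) ≡ 1ℤ + 0ℤ * M + + 2 * x
      lemma = solve-∀

  index-extremeD : ∀ e → + Differences.index (extremeD e) ≡ ⟦ extremeForm e ⟧ 0ℤ
  index-extremeD bottom = lemma M
    where
      lemma : ∀ M → 0ℤ ≡ 0ℤ + 0ℤ * M + 0ℤ * 0ℤ
      lemma = solve-∀
  index-extremeD top = begin
    + suc (n ℕ.+ n)       ≡⟨ ℤ.pos-+ 1 (n ℕ.+ n) ⟩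
    1ℤ + + (n ℕ.+ n)      ≡⟨ cong (_+_ 1ℤ) (ℤ.pos-+ n n) ⟩
    1ℤ + (+ n + + n)      ≡⟨ lemma (+ n) ⟩
    -1ℤ + + 2 * (1ℤ + + n) + 0ℤ * 0ℤ  ≡⟨ cong (λ M′ → -1ℤ + + 2 * M′ + 0ℤ * 0ℤ) (sym M≡1+n) ⟩
    ⟦ extremeForm top ⟧ 0ℤ ∎
    where
      open ≡-Reasoning
      lemma : ∀ a → 1ℤ + (a + a) ≡ -1ℤ + + 2 * (1ℤ + a) + 0ℤ * 0ℤ
      lemma = solve-∀

  vertexForms : ∀ s j → sideLabel s j ≋ offsetForm (sidePart s j) [ zeroForm ] ⊕ blockForm (half j) [ orientationForm oppositeₘ (orientation s (half j)) ]
  vertexForms tail = from-yes (Fin.all? λ j →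
    sideLabel tail j ≋? offsetForm (sidePart tail j) [ zeroForm ] ⊕ blockForm (half j) [ orientationForm oppositeₘ (orientation tail (half j)) ])
  vertexForms head = from-yes (Fin.all? λ j →
    sideLabel head j ≋? offsetForm (sidePart head j) [ zeroForm ] ⊕ blockForm (half j) [ orientationForm oppositeₘ (orientation head (half j)) ])

  finalForms : ∀ j → finalLabel j ≋ offsetForm (finalPart j)
  finalForms = from-yes (Fin.all? λ j → finalLabel j ≋? offsetForm (finalPart j))

  label-vertex : ∀ j p → labelAt j p ≈ offset (partAt j p) + + Blocks.index (blockAt j p)
  label-vertex j (at s k) = begin
    ⟦ sideLabel s j ⟧ (toℤ k)
      ≈⟨ ≋⇒≈ (sideLabel s j) (offsetForm P [ zeroForm ] ⊕ blockForm h [ orientationForm oppositeₘ ω ]) (toℤ k) (vertexForms s j) ⟩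
    ⟦ offsetForm P [ zeroForm ] ⊕ blockForm h [ orientationForm oppositeₘ ω ] ⟧ (toℤ k)
      ≡⟨ evaluate-⊕ M (offsetForm P [ zeroForm ]) (blockForm h [ orientationForm oppositeₘ ω ]) (toℤ k) ⟩
    ⟦ offsetForm P [ zeroForm ] ⟧ (toℤ k) + ⟦ blockForm h [ orientationForm oppositeₘ ω ] ⟧ (toℤ k)
      ≡⟨ cong₂ _+_ (⟦[zeroForm]⟧ (offsetForm P) (toℤ k)) (evaluate-[] M (blockForm h) (orientationForm oppositeₘ ω) (toℤ k)) ⟩
    offset P + ⟦ blockForm h ⟧ (⟦ orientationForm oppositeₘ ω ⟧ (toℤ k))
      ≡⟨ cong (λ x → offset P + ⟦ blockForm h ⟧ x) (sym (toℤ-orient oppositeₘ toℤ-oppositeₘ ω k)) ⟩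
    offset P + ⟦ blockForm h ⟧ (toℤ (orient ω k))
      ≡⟨ cong (_+_ (offset P)) (sym (index-inHalf h (orient ω k))) ⟩
    offset P + + Blocks.index (inHalf h (orient ω k))
      ∎
    where
      open ≈-Reasoning
      P = sidePart s j
      h = half j
      ω = orientation s h
  label-vertex j final = ≈-trans (≋⇒≈ (finalLabel j) (offsetForm (finalPart j)) 0ℤ (finalForms j))
                                 (≡⇒≈ (sym (ℤ.+-identityʳ (offset (finalPart j)))))

  StepType : Set
  StepType = Fin 6 × Fin 5 × Difference

  cornerType : Fin 6 → Corner → StepType
  cornerType j c = let (o , ρ , e) = corner j c in o , ρ , extremeD e

  headStepType : Fin 6 → ∀ {k : Fin m} → View k → StepType
  headStepType j (‵inject₁ i) = partner j , partnerRotation j , oddD (orient (orientation tail (half j)) i)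
  headStepType j ‵fromℕ = cornerType j intoFinal

  stepType : Fin 6 → Stage → StepType
  stepType j (at tail k) = j , 0F , evenD (orient (orientation head (half j)) k)
  stepType j (at head k) = headStepType j (view k)
  stepType j final = cornerType j outOfFinal

  stepOrbit : Fin 6 → Stage → Fin 6
  stepOrbit j p = proj₁ (stepType j p)

  stepRotation : Fin 6 → Stage → Fin 5
  stepRotation j p = proj₁ (proj₂ (stepType j p))

  stepDifference : Fin 6 → Stage → Difference
  stepDifference j p = proj₂ (proj₂ (stepType j p))

  cornerStage : Corner → Stage
  cornerStage intoFinal = at head (Fin.fromℕ n)
  cornerStage outOfFinal = final

  stepSource : Fin 6 → Difference → Fin 6 × Stage
  stepSource o (evenD k) = o , at tail (orient (orientation head (half o)) k)
  stepSource o (oddD i) = partner o , at head (Fin.inject₁ (orient (orientation tail (half (partner o))) i))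
  stepSource o (extremeD e) = let (j , c) = cornerSource o e in j , cornerStage c

  stepType-cornerStage : ∀ j c → stepType j (cornerStage c) ≡ cornerType j c
  stepType-cornerStage j intoFinal = cong (headStepType j) (view-fromℕ n)
  stepType-cornerStage j outOfFinal = refl

  partner-involutive : ∀ j → partner (partner j) ≡ j
  partner-involutive = from-yes (Fin.all? λ j → partner (partner j) Fin.≟ j)

  cornerSource-corner : ∀ j c → let (o , _ , e) = corner j c in cornerSource o e ≡ (j , c)
  cornerSource-corner j intoFinal = checked j
    where
      checked : ∀ j → let (o , _ , e) = corner j intoFinal in cornerSource o e ≡ (j , intoFinal)
      checked = from-yes (Fin.all? λ j → let (o , _ , e) = corner j intoFinal in ≡-dec Fin._≟_ _≟ᶜ_ (cornerSource o e) (j , intoFinal))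
  cornerSource-corner j outOfFinal = checked j
    where
      checked : ∀ j → let (o , _ , e) = corner j outOfFinal in cornerSource o e ≡ (j , outOfFinal)
      checked = from-yes (Fin.all? λ j → let (o , _ , e) = corner j outOfFinal in ≡-dec Fin._≟_ _≟ᶜ_ (cornerSource o e) (j , outOfFinal))

  corner-cornerSource : ∀ o e → let (j , c) = cornerSource o e ; (o′ , _ , e′) = corner j c in (o′ , e′) ≡ (o , e)
  corner-cornerSource o bottom = checked o
    where
      checked : ∀ o → let (j , c) = cornerSource o bottom ; (o′ , _ , e′) = corner j c in (o′ , e′) ≡ (o , bottom)
      checked = from-yes (Fin.all? λ o → let (j , c) = cornerSource o bottom ; (o′ , _ , e′) = corner j c in
        ≡-dec Fin._≟_ _≟ᵉ_ (o′ , e′) (o , bottom))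
  corner-cornerSource o top = checked o
    where
      checked : ∀ o → let (j , c) = cornerSource o top ; (o′ , _ , e′) = corner j c in (o′ , e′) ≡ (o , top)
      checked = from-yes (Fin.all? λ o → let (j , c) = cornerSource o top ; (o′ , _ , e′) = corner j c in
        ≡-dec Fin._≟_ _≟ᵉ_ (o′ , e′) (o , top))

  stepSource-stepType : ∀ j p → stepSource (stepOrbit j p) (stepDifference j p) ≡ (j , p)
  stepSource-stepType j (at tail k) = cong (λ k′ → j , at tail k′) (orient-involutive (orientation head (half j)) k)
  stepSource-stepType j (at head k) = fromHead (view k)
    where
      fromHead : ∀ {k} (v : View k) → let (o , _ , d) = headStepType j v in stepSource o d ≡ (j , at head k)
      fromHead (‵inject₁ i) = begin
        partner (partner j) , at head (Fin.inject₁ (orient (orientation tail (half (partner (partner j)))) (orient ω i)))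
          ≡⟨ cong (λ j′ → j′ , at head (Fin.inject₁ (orient (orientation tail (half j′)) (orient ω i)))) (partner-involutive j) ⟩
        j , at head (Fin.inject₁ (orient ω (orient ω i)))
          ≡⟨ cong (λ i′ → j , at head (Fin.inject₁ i′)) (orient-involutive ω i) ⟩
        j , at head (Fin.inject₁ i)
          ∎
        where
          open ≡-Reasoning
          ω = orientation tail (half j)
      fromHead ‵fromℕ = cong (λ (j′ , c) → j′ , cornerStage c) (cornerSource-corner j intoFinal)
  stepSource-stepType j final = cong (λ (j′ , c) → j′ , cornerStage c) (cornerSource-corner j outOfFinal)

  stepType-stepSource : ∀ o d → let (j , p) = stepSource o d in (stepOrbit j p , stepDifference j p) ≡ (o , d)
  stepType-stepSource o (evenD k) = cong (λ k′ → o , evenD k′) (orient-involutive (orientation head (half o)) k)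
  stepType-stepSource o (oddD i) = begin
    (proj₁ (headStepType j (view (Fin.inject₁ x))) , proj₂ (proj₂ (headStepType j (view (Fin.inject₁ x)))))
      ≡⟨ cong (λ v → proj₁ (headStepType j v) , proj₂ (proj₂ (headStepType j v))) (view-inject₁ x) ⟩
    (partner j , oddD (orient ω x))
      ≡⟨ cong₂ (λ o′ i′ → o′ , oddD i′) (partner-involutive o) (orient-involutive ω i) ⟩
    (o , oddD i)
      ∎
    where
      open ≡-Reasoning
      j = partner o
      ω = orientation tail (half j)
      x = orient ω i
  stepType-stepSource o (extremeD e) = begin
    (proj₁ (stepType j (cornerStage c)) , proj₂ (proj₂ (stepType j (cornerStage c))))
      ≡⟨ cong (λ τ → proj₁ τ , proj₂ (proj₂ τ)) (stepType-cornerStage j c) ⟩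
    (proj₁ (corner j c) , extremeD (proj₂ (proj₂ (corner j c))))
      ≡⟨ cong (λ (o′ , e′) → o′ , extremeD e′) (corner-cornerSource o e) ⟩
    (o , extremeD e)
      ∎
    where
      open ≡-Reasoning
      j = proj₁ (cornerSource o e)
      c = proj₂ (cornerSource o e)

  cornerParts : Fin 6 → Corner → Fin 6 × Fin 6
  cornerParts j intoFinal = orbitHead j , finalPart j
  cornerParts j outOfFinal = finalPart j , orbitTail j

  partner-parts : ∀ j → rotatedRepresentative (partner j , partnerRotation j) ≡ (orbitHead j , orbitTail j)
  partner-parts = from-yes (Fin.all? λ j →
    ≡-dec Fin._≟_ Fin._≟_ (rotatedRepresentative (partner j , partnerRotation j)) (orbitHead j , orbitTail j))

  corner-parts : ∀ j c → let (o , ρ , _) = corner j c in rotatedRepresentative (o , ρ) ≡ cornerParts j c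
  corner-parts j intoFinal = checked j
    where
      checked : ∀ j → let (o , ρ , _) = corner j intoFinal in rotatedRepresentative (o , ρ) ≡ cornerParts j intoFinal
      checked = from-yes (Fin.all? λ j → let (o , ρ , _) = corner j intoFinal in
        ≡-dec Fin._≟_ Fin._≟_ (rotatedRepresentative (o , ρ)) (cornerParts j intoFinal))
  corner-parts j outOfFinal = checked j
    where
      checked : ∀ j → let (o , ρ , _) = corner j outOfFinal in rotatedRepresentative (o , ρ) ≡ cornerParts j outOfFinal
      checked = from-yes (Fin.all? λ j → let (o , ρ , _) = corner j outOfFinal in
        ≡-dec Fin._≟_ Fin._≟_ (rotatedRepresentative (o , ρ)) (cornerParts j outOfFinal))

  step-parts : ∀ j p → (partAt j p , partAt j (succ p)) ≡ rotatedRepresentative (stepOrbit j p , stepRotation j p)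
  step-parts j (at tail k) = sym (cong₂ _,_ (rotate-zero (orbitTail j)) (rotate-zero (orbitHead j)))
  step-parts j (at head k) = fromHead (view k)
    where
      fromHead : ∀ {k} (v : View k) → let (o , ρ , _) = headStepType j v in
                 (orbitHead j , partAt j (afterHead v)) ≡ rotatedRepresentative (o , ρ)
      fromHead (‵inject₁ i) = sym (partner-parts j)
      fromHead ‵fromℕ = sym (corner-parts j intoFinal)
  step-parts j final = sym (corner-parts j outOfFinal)

  shift : Fin 6 → ℤ
  shift o = ⟦ shiftForm o ⟧ 0ℤ

  substituted : ∀ a b x {y} → y ≡ ⟦ b ⟧ x → ⟦ a [ b ] ⟧ x ≡ ⟦ a ⟧ y
  substituted a b x y≡ = trans (evaluate-[] M a b x) (cong ⟦ a ⟧ (sym y≡))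

  tailStepForms : ∀ j → sideLabel head j ⊖ sideLabel tail j
                        ≋ shiftForm j [ zeroForm ] ⊕ evenForm [ orientationForm oppositeₘ (orientation head (half j)) ]
  tailStepForms = from-yes (Fin.all? λ j → sideLabel head j ⊖ sideLabel tail j
                        ≋? shiftForm j [ zeroForm ] ⊕ evenForm [ orientationForm oppositeₘ (orientation head (half j)) ])

  headStepForms : ∀ j → sideLabel tail j [ succForm ] ⊖ sideLabel head j
                        ≋ shiftForm (partner j) [ zeroForm ] ⊕ oddForm [ orientationForm oppositeₙ (orientation tail (half j)) ]
  headStepForms = from-yes (Fin.all? λ j → sideLabel tail j [ succForm ] ⊖ sideLabel head j
                        ≋? shiftForm (partner j) [ zeroForm ] ⊕ oddForm [ orientationForm oppositeₙ (orientation tail (half j)) ])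

  cornerLabels : Fin 6 → Corner → Affine × Affine
  cornerLabels j intoFinal = finalLabel j , sideLabel head j [ lastForm ]
  cornerLabels j outOfFinal = sideLabel tail j [ zeroForm ] , finalLabel j

  cornerStepForms : ∀ j c → let (a , b) = cornerLabels j c ; (o , _ , e) = corner j c in a ⊖ b ≋ shiftForm o ⊕ extremeForm e
  cornerStepForms j intoFinal = checked j
    where
      checked : ∀ j → let (a , b) = cornerLabels j intoFinal ; (o , _ , e) = corner j intoFinal in a ⊖ b ≋ shiftForm o ⊕ extremeForm e
      checked = from-yes (Fin.all? λ j → let (a , b) = cornerLabels j intoFinal ; (o , _ , e) = corner j intoFinal in
        a ⊖ b ≋? shiftForm o ⊕ extremeForm e)
  cornerStepForms j outOfFinal = checked j
    where
      checked : ∀ j → let (a , b) = cornerLabels j outOfFinal ; (o , _ , e) = corner j outOfFinal in a ⊖ b ≋ shiftForm o ⊕ extremeForm e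
      checked = from-yes (Fin.all? λ j → let (a , b) = cornerLabels j outOfFinal ; (o , _ , e) = corner j outOfFinal in
        a ⊖ b ≋? shiftForm o ⊕ extremeForm e)

  corner-label : ∀ j c → let (a , b) = cornerLabels j c ; (o , _ , e) = corner j c in
                 ⟦ a ⟧ 0ℤ - ⟦ b ⟧ 0ℤ ≈ shift o + + Differences.index (extremeD e)
  corner-label j c = begin
    ⟦ a ⟧ 0ℤ - ⟦ b ⟧ 0ℤ                            ≈⟨ difference-≈ a b (shiftForm o) (extremeForm e) 0ℤ (cornerStepForms j c) ⟩
    shift o + ⟦ extremeForm e ⟧ 0ℤ                  ≡⟨ cong (_+_ (shift o)) (sym (index-extremeD e)) ⟩
    shift o + + Differences.index (extremeD e)      ∎
    where
      open ≈-Reasoning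
      a = proj₁ (cornerLabels j c)
      b = proj₂ (cornerLabels j c)
      o = proj₁ (corner j c)
      e = proj₂ (proj₂ (corner j c))

  tail-step-label : ∀ j k → let ω = orientation head (half j) in
                    labelAt j (at head k) - labelAt j (at tail k) ≈ shift j + + Differences.index (evenD (orient ω k))
  tail-step-label j k = begin
    ⟦ sideLabel head j ⟧ (toℤ k) - ⟦ sideLabel tail j ⟧ (toℤ k)
      ≈⟨ difference-≈ (sideLabel head j) (sideLabel tail j) (shiftForm j [ zeroForm ]) (evenForm [ orientationForm oppositeₘ ω ])
                      (toℤ k) (tailStepForms j) ⟩
    ⟦ shiftForm j [ zeroForm ] ⟧ (toℤ k) + ⟦ evenForm [ orientationForm oppositeₘ ω ] ⟧ (toℤ k)
      ≡⟨ cong₂ _+_ (⟦[zeroForm]⟧ (shiftForm j) (toℤ k))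
                   (substituted evenForm (orientationForm oppositeₘ ω) (toℤ k) (toℤ-orient oppositeₘ toℤ-oppositeₘ ω k)) ⟩
    shift j + ⟦ evenForm ⟧ (toℤ (orient ω k))
      ≡⟨ cong (_+_ (shift j)) (sym (index-evenD (orient ω k))) ⟩
    shift j + + Differences.index (evenD (orient ω k))
      ∎
    where
      open ≈-Reasoning
      ω = orientation head (half j)

  head-step-label : ∀ j i → let ω = orientation tail (half j) in
                    labelAt j (at tail (Fin.suc i)) - labelAt j (at head (Fin.inject₁ i))
                    ≈ shift (partner j) + + Differences.index (oddD (orient ω i))
  head-step-label j i = begin
    ⟦ sideLabel tail j ⟧ (toℤ (Fin.suc i)) - ⟦ sideLabel head j ⟧ (toℤ (Fin.inject₁ i))
      ≡⟨ cong₂ _-_ (sym (substituted (sideLabel tail j) succForm (toℤ i) (toℤ-suc i)))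
                   (cong (λ z → ⟦ sideLabel head j ⟧ (+ z)) (Fin.toℕ-inject₁ i)) ⟩
    ⟦ sideLabel tail j [ succForm ] ⟧ (toℤ i) - ⟦ sideLabel head j ⟧ (toℤ i)
      ≈⟨ difference-≈ (sideLabel tail j [ succForm ]) (sideLabel head j) (shiftForm (partner j) [ zeroForm ])
                      (oddForm [ orientationForm oppositeₙ ω ]) (toℤ i) (headStepForms j) ⟩
    ⟦ shiftForm (partner j) [ zeroForm ] ⟧ (toℤ i) + ⟦ oddForm [ orientationForm oppositeₙ ω ] ⟧ (toℤ i)
      ≡⟨ cong₂ _+_ (⟦[zeroForm]⟧ (shiftForm (partner j)) (toℤ i))
                   (substituted oddForm (orientationForm oppositeₙ ω) (toℤ i) (toℤ-orient oppositeₙ toℤ-oppositeₙ ω i)) ⟩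
    shift (partner j) + ⟦ oddForm ⟧ (toℤ (orient ω i))
      ≡⟨ cong (_+_ (shift (partner j))) (sym (index-oddD (orient ω i))) ⟩
    shift (partner j) + + Differences.index (oddD (orient ω i))
      ∎
    where
      open ≈-Reasoning
      ω = orientation tail (half j)

  step-label : ∀ j p → labelAt j (succ p) - labelAt j p ≈ shift (stepOrbit j p) + + Differences.index (stepDifference j p)
  step-label j (at tail k) = tail-step-label j k
  step-label j (at head k) = fromHead (view k)
    where
      fromHead : ∀ {k} (v : View k) → let (o , _ , d) = headStepType j v in
                 labelAt j (afterHead v) - labelAt j (at head k) ≈ shift o + + Differences.index d
      fromHead (‵inject₁ i) = head-step-label j i
      fromHead ‵fromℕ = ≈-trans
        (≡⇒≈ (cong (λ z → ⟦ finalLabel j ⟧ 0ℤ - z) (sym (substituted (sideLabel head j) lastForm 0ℤ toℤ-fromℕ))))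
        (corner-label j intoFinal)
  step-label j final = ≈-trans
    (≡⇒≈ (cong (λ z → z - ⟦ finalLabel j ⟧ 0ℤ) (sym (⟦[zeroForm]⟧ (sideLabel tail j) 0ℤ))))
    (corner-label j outOfFinal)

  locate : Fin 6 × Stage → Position
  locate (j , p) = j , Stages.toFin p

  basePart : Position → Fin 6
  basePart (j , i) = partAt j (Stages.fromFin i)

  baseLabel : Position → ℤ
  baseLabel (j , i) = labelAt j (Stages.fromFin i)

  step-orbit : ∀ j p → orbit (partAt j p , partAt j (succ p)) ≡ stepOrbit j p
  step-orbit j p = cong proj₁ (trans (cong orbitOf (step-parts j p))
                                     (orbitOf-rotatedRepresentative (stepOrbit j p , stepRotation j p)))

  vertex-residue : ∀ j p → toℤ (reduce (labelAt j p)) - offset (partAt j p) ≈ toℤ (Blocks.toFin (blockAt j p))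
  vertex-residue j p = begin
    toℤ (reduce (labelAt j p)) - offset P   ≈⟨ +-cong (reduce-≈ (labelAt j p)) (≈-refl { - offset P }) ⟩
    labelAt j p - offset P                  ≈⟨ +-cong (label-vertex j p) (≈-refl { - offset P }) ⟩
    offset P + + Blocks.index b - offset P  ≡⟨ cancel (offset P) (+ Blocks.index b) ⟩
    + Blocks.index b                        ≡⟨ cong +_ (sym (Blocks.toℕ-toFin b)) ⟩
    toℤ (Blocks.toFin b)                    ∎
    where
      open ≈-Reasoning
      P = partAt j p
      b = blockAt j p
      cancel : ∀ a x → a + x - a ≡ x
      cancel = solve-∀

  label-cellOf : ∀ P (w : Fin t) → let (j , p) = cellOf P (Blocks.fromFin (reduce (toℤ w - offset P))) in labelAt j p ≈ toℤ w
  label-cellOf P w = begin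
    labelAt j p                                        ≈⟨ label-vertex j p ⟩
    offset (partAt j p) + + Blocks.index (blockAt j p) ≡⟨ cong (λ (P′ , b′) → offset P′ + + Blocks.index b′) (vertex-cellOf P b) ⟩
    offset P + + Blocks.index b                        ≡⟨ cong (λ z → offset P + + z) (Blocks.index-fromFin w′) ⟩
    offset P + toℤ w′                                  ≈⟨ +-cong (≈-refl {offset P}) (reduce-≈ (toℤ w - offset P)) ⟩
    offset P + (toℤ w - offset P)                      ≡⟨ cancel (offset P) (toℤ w) ⟩
    toℤ w                                              ∎
    where
      open ≈-Reasoning
      w′ = reduce (toℤ w - offset P)
      b = Blocks.fromFin w′
      j = proj₁ (cellOf P b)
      p = proj₂ (cellOf P b)
      cancel : ∀ a x → a + (x - a) ≡ x
      cancel = solve-∀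

  baseVertex⁻¹ : Fin 6 × Fin t → Position
  baseVertex⁻¹ (P , w) = locate (cellOf P (Blocks.fromFin (reduce (toℤ w - offset P))))

  baseVertex⁻¹-inverseˡ : ∀ q → baseVertex⁻¹ (basePart q , reduce (baseLabel q)) ≡ q
  baseVertex⁻¹-inverseˡ (j , i) = begin
    locate (cellOf P (Blocks.fromFin (reduce (toℤ (reduce (labelAt j p)) - offset P))))
      ≡⟨ cong (λ w → locate (cellOf P (Blocks.fromFin w))) (reduce-unique (Blocks.toFin b) (vertex-residue j p)) ⟩
    locate (cellOf P (Blocks.fromFin (Blocks.toFin b)))
      ≡⟨ cong (locate ∘ cellOf P) (Blocks.fromFin-toFin b) ⟩
    locate (cellOf P b)
      ≡⟨ cong locate (cellOf-vertex j p) ⟩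
    j , Stages.toFin p
      ≡⟨ cong (j ,_) (Stages.toFin-fromFin i) ⟩
    j , i
      ∎
    where
      open ≡-Reasoning
      p = Stages.fromFin i
      P = partAt j p
      b = blockAt j p

  baseVertex⁻¹-inverseʳ : ∀ v → let q = baseVertex⁻¹ v in (basePart q , reduce (baseLabel q)) ≡ v
  baseVertex⁻¹-inverseʳ (P , w) = begin
    partAt j (Stages.fromFin (Stages.toFin p)) , reduce (labelAt j (Stages.fromFin (Stages.toFin p)))
      ≡⟨ cong (λ p′ → partAt j p′ , reduce (labelAt j p′)) (Stages.fromFin-toFin p) ⟩
    partAt j p , reduce (labelAt j p)
      ≡⟨ cong₂ _,_ (cong proj₁ (vertex-cellOf P b)) (reduce-unique w (label-cellOf P w)) ⟩
    P , w
      ∎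
    where
      open ≡-Reasoning
      b = Blocks.fromFin (reduce (toℤ w - offset P))
      j = proj₁ (cellOf P b)
      p = proj₂ (cellOf P b)

  step-residue : ∀ j p → toℤ (reduce (labelAt j (succ p) - labelAt j p)) - shift (stepOrbit j p)
                         ≈ toℤ (Differences.toFin (stepDifference j p))
  step-residue j p = begin
    toℤ (reduce (labelAt j (succ p) - labelAt j p)) - shift o  ≈⟨ +-cong (reduce-≈ (labelAt j (succ p) - labelAt j p)) (≈-refl { - shift o }) ⟩
    labelAt j (succ p) - labelAt j p - shift o                 ≈⟨ +-cong (step-label j p) (≈-refl { - shift o }) ⟩
    shift o + + Differences.index d - shift o                  ≡⟨ cancel (shift o) (+ Differences.index d) ⟩
    + Differences.index d                                      ≡⟨ cong +_ (sym (Differences.toℕ-toFin d)) ⟩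
    toℤ (Differences.toFin d)                                  ∎
    where
      open ≈-Reasoning
      o = stepOrbit j p
      d = stepDifference j p
      cancel : ∀ a x → a + x - a ≡ x
      cancel = solve-∀

  label-stepSource : ∀ o (s : Fin t) → let (j , p) = stepSource o (Differences.fromFin (reduce (toℤ s - shift o))) in
                     labelAt j (succ p) - labelAt j p ≈ toℤ s
  label-stepSource o s = begin
    labelAt j (succ p) - labelAt j p                       ≈⟨ step-label j p ⟩
    shift (stepOrbit j p) + + Differences.index (stepDifference j p)
                                                           ≡⟨ cong (λ (o′ , d′) → shift o′ + + Differences.index d′) (stepType-stepSource o d) ⟩
    shift o + + Differences.index d                        ≡⟨ cong (λ z → shift o + + z) (Differences.index-fromFin s′) ⟩
    shift o + toℤ s′                                       ≈⟨ +-cong (≈-refl {shift o}) (reduce-≈ (toℤ s - shift o)) ⟩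
    shift o + (toℤ s - shift o)                            ≡⟨ cancel (shift o) (toℤ s) ⟩
    toℤ s                                                  ∎
    where
      open ≈-Reasoning
      s′ = reduce (toℤ s - shift o)
      d = Differences.fromFin s′
      j = proj₁ (stepSource o d)
      p = proj₂ (stepSource o d)
      cancel : ∀ a x → a + (x - a) ≡ x
      cancel = solve-∀

  baseArc : Position → Fin 6 × Fin t
  baseArc (j , i) = orbit (basePart (j , i) , basePart (j , next i)) , reduce (baseLabel (j , next i) - baseLabel (j , i))

  baseArc-stage : ∀ j i → let p = Stages.fromFin i in
                  baseArc (j , i) ≡ (stepOrbit j p , reduce (labelAt j (succ p) - labelAt j p))
  baseArc-stage j i = begin
    orbit (partAt j p , partAt j (Stages.fromFin (next i))) , reduce (labelAt j (Stages.fromFin (next i)) - labelAt j p)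
      ≡⟨ cong (λ p′ → orbit (partAt j p , partAt j p′) , reduce (labelAt j p′ - labelAt j p)) (fromFin-next i) ⟩
    orbit (partAt j p , partAt j (succ p)) , reduce (labelAt j (succ p) - labelAt j p)
      ≡⟨ cong (_, reduce (labelAt j (succ p) - labelAt j p)) (step-orbit j p) ⟩
    stepOrbit j p , reduce (labelAt j (succ p) - labelAt j p)
      ∎
    where
      open ≡-Reasoning
      p = Stages.fromFin i

  baseArc⁻¹ : Fin 6 × Fin t → Position
  baseArc⁻¹ (o , s) = locate (stepSource o (Differences.fromFin (reduce (toℤ s - shift o))))

  baseArc⁻¹-inverseˡ : ∀ q → baseArc⁻¹ (baseArc q) ≡ q
  baseArc⁻¹-inverseˡ (j , i) = begin
    baseArc⁻¹ (baseArc (j , i))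
      ≡⟨ cong baseArc⁻¹ (baseArc-stage j i) ⟩
    locate (stepSource o (Differences.fromFin (reduce (toℤ (reduce (labelAt j (succ p) - labelAt j p)) - shift o))))
      ≡⟨ cong (λ s → locate (stepSource o (Differences.fromFin s))) (reduce-unique (Differences.toFin d) (step-residue j p)) ⟩
    locate (stepSource o (Differences.fromFin (Differences.toFin d)))
      ≡⟨ cong (locate ∘ stepSource o) (Differences.fromFin-toFin d) ⟩
    locate (stepSource o d)
      ≡⟨ cong locate (stepSource-stepType j p) ⟩
    j , Stages.toFin p
      ≡⟨ cong (j ,_) (Stages.toFin-fromFin i) ⟩
    j , i
      ∎
    where
      open ≡-Reasoning
      p = Stages.fromFin i
      o = stepOrbit j p
      d = stepDifference j p

  baseArc⁻¹-inverseʳ : ∀ a → baseArc (baseArc⁻¹ a) ≡ a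
  baseArc⁻¹-inverseʳ (o , s) = begin
    baseArc (j , Stages.toFin p)
      ≡⟨ baseArc-stage j (Stages.toFin p) ⟩
    stepOrbit j p′ , reduce (labelAt j (succ p′) - labelAt j p′)
      ≡⟨ cong (λ p″ → stepOrbit j p″ , reduce (labelAt j (succ p″) - labelAt j p″)) (Stages.fromFin-toFin p) ⟩
    stepOrbit j p , reduce (labelAt j (succ p) - labelAt j p)
      ≡⟨ cong₂ _,_ (cong proj₁ (stepType-stepSource o d)) (reduce-unique s (label-stepSource o s)) ⟩
    o , s
      ∎
    where
      open ≡-Reasoning
      d = Differences.fromFin (reduce (toℤ s - shift o))
      j = proj₁ (stepSource o d)
      p = proj₂ (stepSource o d)
      p′ = Stages.fromFin (Stages.toFin p)

  part-changes : ∀ q → basePart q ≢ basePart (successor q)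
  part-changes (j , i) same = rotatedRepresentative-distinct (stepOrbit j p , stepRotation j p) (begin
    proj₁ (rotatedRepresentative (stepOrbit j p , stepRotation j p))  ≡⟨ cong proj₁ (sym (step-parts j p)) ⟩
    partAt j p                                                         ≡⟨ same ⟩
    partAt j (Stages.fromFin (next i))                                 ≡⟨ cong (partAt j) (fromFin-next i) ⟩
    partAt j (succ p)                                                  ≡⟨ cong proj₂ (step-parts j p) ⟩
    proj₂ (rotatedRepresentative (stepOrbit j p , stepRotation j p))  ∎)
    where
      open ≡-Reasoning
      p = Stages.fromFin i

  baseFactor : BaseFactor
  baseFactor = record
    { part = basePart
    ; label = baseLabel
    ; part-changes = part-changes
    ; vertexType⁻¹ = baseVertex⁻¹
    ; vertexType⁻¹-inverseˡ = baseVertex⁻¹-inverseˡ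
    ; vertexType⁻¹-inverseʳ = baseVertex⁻¹-inverseʳ
    ; arcType⁻¹ = baseArc⁻¹
    ; arcType⁻¹-inverseˡ = baseArc⁻¹-inverseˡ
    ; arcType⁻¹-inverseʳ = baseArc⁻¹-inverseʳ
    }

  factorization : CFactorization t (K* 6 t)
  factorization = develop baseFactor

odd≥3⇒1+2[1+n] : ∀ t → 3 ≤ t → ¬ (2 ∣ t) → ∃[ n ] t ≡ suc (suc n ℕ.+ suc n)
odd≥3⇒1+2[1+n] t 3≤t t-odd with parity t
... | even q = ⊥-elim (t-odd (divides q (trans (cong (q ℕ.+_) (sym (ℕ.+-identityʳ q))) (ℕ.*-comm 2 q))))
odd≥3⇒1+2[1+n] _ (ℕ.s≤s ()) _ | odd zero
... | odd (suc n) = n , refl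

lemma6p6 : (t : ℕ) → 3 ≤ t → ¬ (2 ∣ t) → CFactorization t (K* 6 t)
lemma6p6 t 3≤t t-odd = let (n , t≡) = odd≥3⇒1+2[1+n] t 3≤t t-odd in
  subst (λ t′ → CFactorization t′ (K* 6 t′)) (sym t≡) (Construction.factorization n)
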